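{- Let $\mathcal{T}$ be an oscillating tableau of length $r$ and suppose $\mathrm{Sun}_1(\mathcal{T})=(\iota,T)$. Then $\mathrm{Des}(\mathcal{T})=\mathrm{Des}(\iota,T)$.
   Context: An oscillating tableau of length $r$ is a sequence of partitions $(\emptyset=\mu^0,\dots,\mu^r)$ with consecutive Ferrers diagrams (English notation) differing by exactly one box; step $k$ is an expansion (box $b_k$ added) or contraction (box $b_k$ deleted). $k\in\{1,\dots,r-1\}$ is a descent of $\mathcal{T}$ if step $k$ is an expansion and step $k+1$ a contraction; or both are expansions with $b_k$ in a row strictly above $b_{k+1}$; or both are contractions with $b_k$ in a row strictly below $b_{k+1}$; $\mathrm{Des}(\mathcal{T})$ is the set of descents. $\mathrm{Sun}_1$: set $\iota_0=\emptyset$, $T_0=\emptyset$; for $k=1,\dots,r$: if step $k$ is an expansion, $\iota_k=\iota_{k-1}$ and $T_k$ is $T_{k-1}$ with $k$ placed in box $b_k$; if step $k$ is a contraction, apply Robinson–Schensted column deletion (inverse of column insertion) to $T_{k-1}$ starting at the corner box $b_k$, yielding an ejected letter $x$ and tableau $T_k$, and let $\iota_k$ be $\iota_{k-1}$ with the transposition $(x,k)$ adjoined. Then $\mathrm{Sun}_1(\mathcal{T})=(\iota_r,T_r)$, where $\iota=\iota_r$ is a fixed-point-free involution on a set $A\subseteq\{1,\dots,r\}$ and $T=T_r$ is a partial Young tableau (distinct entries increasing along rows and columns) with entry set $\{1,\dots,r\}\setminus A$. Descent sets: $\mathrm{Des}(\iota)=\{k: k,k+1\in A,\ \iota(k)>\iota(k+1)\}$;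 $\mathrm{Des}(T)=\{k: k,k+1 \text{ entries of } T,\ k+1 \text{ in a row strictly below } k\}$; $\mathrm{Des}(T/\iota)=\{k: k \text{ an entry of } T,\ k+1\in A\}$; and $\mathrm{Des}(\iota,T)=\mathrm{Des}(\iota)\cup\mathrm{Des}(T)\cup\mathrm{Des}(T/\iota)$ (a disjoint union). -}

module Defs where

open import Data.Nat using (ℕ; zero; suc; _+_; _∸_; _<_; _<ᵇ_; _≡ᵇ_)
open import Data.Bool using (Bool; true; false; if_then_else_)
open import Data.List using (List; []; _∷_; _++_; length)
open import Data.Maybe using (Maybe; just; nothing)
open import Data.Product using (_×_; _,_; Σ; ∃-syntax)
open import Data.Sum using (_⊎_)
open import Relation.Binary.PropositionalEquality using (_≡_)

-- A shape is a list of row lengths; row 0 is the top row.  Rows beyond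
-- the end of the list have length 0 (trailing zero rows are allowed and
-- irrelevant).

Shape : Set
Shape = List ℕ

rowLen : Shape → ℕ → ℕ
rowLen []       _       = 0
rowLen (a ∷ _)  zero    = a
rowLen (_ ∷ as) (suc i) = rowLen as i

addBox : ℕ → Shape → Shape
addBox zero    []       = 1 ∷ []
addBox zero    (a ∷ as) = suc a ∷ as
addBox (suc i) []       = 0 ∷ addBox i []
addBox (suc i) (a ∷ as) = a ∷ addBox i as

delBox : ℕ → Shape → Shape
delBox _       []       = []
delBox zero    (a ∷ as) = a ∸ 1 ∷ as
delBox (suc i) (a ∷ as) = a ∷ delBox i as

-- Starting from the empty partition, the sequence of partitions
-- μ⁰ = ∅, μ¹, …, μʳ in which consecutive diagrams differ by exactly one
-- box is encoded by the sequence of its steps: step k either adds the box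
-- b_k at the end of row i (expansion) or deletes the box b_k at the end of
-- row i (contraction).

data Step : Set where
  expand   : ℕ → Step
  contract : ℕ → Step

CanAdd : Shape → ℕ → Set
CanAdd μ zero    = Data.Unit.⊤ where import Data.Unit
CanAdd μ (suc i) = rowLen μ (suc i) < rowLen μ i

CanDel : Shape → ℕ → Set
CanDel μ i = (0 < rowLen μ i) × (rowLen μ (suc i) < rowLen μ i)

applyStep : Step → Shape → Shape
applyStep (expand i)   μ = addBox i μ
applyStep (contract i) μ = delBox i μ

StepOK : Shape → Step → Set
StepOK μ (expand i)   = CanAdd μ i
StepOK μ (contract i) = CanDel μ i

ValidFrom : Shape → List Step → Set
ValidFrom μ []       = Data.Unit.⊤ where import Data.Unit
ValidFrom μ (s ∷ ss) = StepOK μ s × ValidFrom (applyStep s μ) ss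

record OscTab (r : ℕ) : Set where
  constructor osc
  field
    steps  : List Step
    len    : length steps ≡ r
    valid  : ValidFrom [] steps
open OscTab public

-- step k (1-based)
stepAt : List Step → ℕ → Maybe Step
stepAt _        zero          = nothing
stepAt []       (suc _)       = nothing
stepAt (s ∷ _)  (suc zero)    = just s
stepAt (_ ∷ ss) (suc (suc k)) = stepAt ss (suc k)

-- descent condition on two consecutive steps (k, k+1).
-- Rows are numbered from the top, so "b_k strictly above b_{k+1}" means
-- row(b_k) < row(b_{k+1}).
DesPair : Step → Step → Set
DesPair (expand _)   (contract _) = Data.Unit.⊤ where import Data.Unit
DesPair (expand i)   (expand j)   = i < j
DesPair (contract i) (contract j) = j < i
DesPair (contract _) (expand _)   = Data.Empty.⊥ where import Data.Empty

DesOsc : List Step → ℕ → Set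
DesOsc ss k = Σ Step λ s → Σ Step λ t →
  (stepAt ss k ≡ just s) × (stepAt ss (suc k) ≡ just t) × DesPair s t

-- Partial tableaux: list of rows (row 0 on top), each row a list of
-- entries from left to right.

Tab : Set
Tab = List (List ℕ)

entryAt : List ℕ → ℕ → Maybe ℕ
entryAt []       _       = nothing
entryAt (x ∷ _)  zero    = just x
entryAt (_ ∷ xs) (suc c) = entryAt xs c

setAt : List ℕ → ℕ → ℕ → List ℕ
setAt []       _       _ = []
setAt (_ ∷ xs) zero    y = y ∷ xs
setAt (x ∷ xs) (suc c) y = x ∷ setAt xs c y

appendRow : ℕ → ℕ → Tab → Tab
appendRow zero    k []         = (k ∷ []) ∷ []
appendRow zero    k (row ∷ rs) = (row ++ (k ∷ [])) ∷ rs
appendRow (suc i) k []         = [] ∷ appendRow i k []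
appendRow (suc i) k (row ∷ rs) = row ∷ appendRow i k rs

removeLastL : List ℕ → Maybe (ℕ × List ℕ)
removeLastL []       = nothing
removeLastL (x ∷ []) = just (x , [])
removeLastL (x ∷ xs@(_ ∷ _)) with removeLastL xs
... | just (y , xs') = just (y , x ∷ xs')
... | nothing        = nothing

removeLastRow : ℕ → Tab → Maybe (ℕ × ℕ × Tab)
removeLastRow _       []         = nothing
removeLastRow zero    (row ∷ rs) with removeLastL row
... | just (y , row') = just (y , length row' , row' ∷ rs)
... | nothing         = nothing
removeLastRow (suc i) (row ∷ rs) with removeLastRow i rs
... | just (y , c , rs') = just (y , c , row ∷ rs')
... | nothing            = nothing

-- One step of reverse column bumping: in column c, find the lowest entry
-- smaller than y (= the largest entry of column c smaller than y), replace
-- it by y, and return the replaced entry.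
bumpCol : ℕ → ℕ → Tab → Maybe (ℕ × Tab)
bumpCol c y [] = nothing
bumpCol c y (row ∷ rs) with bumpCol c y rs
... | just (x , rs') = just (x , row ∷ rs')
... | nothing with entryAt row c
...   | nothing = nothing
...   | just e  = if e <ᵇ y then just (e , setAt row c y ∷ rs) else nothing

revBump : ℕ → ℕ → Tab → ℕ × Tab
revBump zero    y T = y , T
revBump (suc c) y T with bumpCol c y T
... | just (x , T') = revBump c x T'
... | nothing       = y , T   -- does not occur for genuine tableaux

-- Robinson–Schensted column deletion starting at the corner box at the
-- end of row i: returns the ejected letter and the new tableau.
colDelete : ℕ → Tab → ℕ × Tab
colDelete i T with removeLastRow i T
... | just (y , c , T') = revBump c y T'
... | nothing           = 0 , T   -- does not occur for valid steps

-- involutions as lists of transpositions (x , k)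
Inv : Set
Inv = List (ℕ × ℕ)

sunFrom : ℕ → Inv → Tab → List Step → Inv × Tab
sunFrom k ι T [] = ι , T
sunFrom k ι T (expand i ∷ ss)   = sunFrom (suc k) ι (appendRow i k T) ss
sunFrom k ι T (contract i ∷ ss) with colDelete i T
... | x , T' = sunFrom (suc k) (ι ++ ((x , k) ∷ [])) T' ss

Sun₁ : {r : ℕ} → OscTab r → Inv × Tab
Sun₁ 𝒯 = sunFrom 1 [] [] (steps 𝒯)

partner : Inv → ℕ → Maybe ℕ
partner []             k = nothing
partner ((a , b) ∷ ps) k =
  if a ≡ᵇ k then just b else if b ≡ᵇ k then just a else partner ps k

memL : ℕ → List ℕ → Bool
memL k []       = false
memL k (x ∷ xs) = if x ≡ᵇ k then true else memL k xs

rowOfFrom : ℕ → ℕ → Tab → Maybe ℕ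
rowOfFrom i k []         = nothing
rowOfFrom i k (row ∷ rs) = if memL k row then just i else rowOfFrom (suc i) k rs

rowOf : Tab → ℕ → Maybe ℕ
rowOf T k = rowOfFrom 0 k T

DesInv : Inv → ℕ → Set
DesInv ι k = Σ ℕ λ a → Σ ℕ λ b →
  (partner ι k ≡ just a) × (partner ι (suc k) ≡ just b) × (b < a)

DesTab : Tab → ℕ → Set
DesTab T k = Σ ℕ λ i → Σ ℕ λ j →
  (rowOf T k ≡ just i) × (rowOf T (suc k) ≡ just j) × (i < j)

DesTabInv : Inv → Tab → ℕ → Set
DesTabInv ι T k = Σ ℕ λ i → Σ ℕ λ a →
  (rowOf T k ≡ just i) × (partner ι (suc k) ≡ just a)

DesIT : Inv × Tab → ℕ → Set
DesIT (ι , T) k = DesInv ι k ⊎ DesTab T k ⊎ DesTabInv ι T k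

module Submission where

-- Whether k is a descent of 𝒯 depends only on the steps k and k+1.
-- Right after processing them, the state (ι , T) of Sun₁ already carries a
-- "witness" of the answer: for a descent, k above k+1 in T, or k in T and
-- k+1 paired by ι, or ι(k) > ι(k+1); for a non-descent, the three dual
-- configurations.  Expansions obviously keep such a witness, and so do
-- contractions, by an analysis of Robinson–Schensted column deletion: the
-- letters k, k+1 keep their relative position unless one of them is
-- ejected, in which case it becomes paired with the current time, which is
-- larger than everything else.  At the end the witness decides Des(ι , T).

open import Defs
open import Function.Bundles using (_⇔_; mk⇔)
open import Function using (_∘_)
open import Function.Properties.Equivalence using () renaming (trans to ⇔-trans)

open import Data.Nat using (ℕ; zero; suc; _+_; _∸_; _<_; _≤_; _<ᵇ_; _≡ᵇ_; z≤n; s≤s; _≟_; _<?_; _≤?_; z<s; s<s)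
open import Data.Nat.Properties
open import Data.Bool using (Bool; true; false) renaming (T to IsTrue)
open import Data.List using (List; []; _∷_; _++_; length)
open import Data.List.Properties using (length-++; ++-assoc)
open import Data.Maybe using (Maybe; just; nothing)
open import Data.Maybe.Properties using (just-injective)
open import Data.Product using (_×_; _,_; Σ; proj₁; proj₂)
open import Data.Sum using (_⊎_; inj₁; inj₂; [_,_]′; map₂)
open import Data.Empty using (⊥; ⊥-elim)
open import Data.Unit using (tt)
open import Relation.Nullary using (¬_; yes; no)
open import Relation.Binary.Definitions using (tri<; tri≈; tri>)
open import Relation.Binary.PropositionalEquality

just≢nothing : ∀ {A : Set} {a : A} → just a ≢ nothing
just≢nothing ()

notJust : ∀ {A : Set} (m : Maybe A) → (∀ {w} → m ≡ just w → ⊥) → m ≡ nothing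
notJust (just w) f = ⊥-elim (f refl)
notJust nothing  f = refl

<ᵇ-true : ∀ {a b} → (a <ᵇ b) ≡ true → a < b
<ᵇ-true {a} {b} e = <ᵇ⇒< a b (subst IsTrue (sym e) tt)

<ᵇ-false : ∀ {a b} → (a <ᵇ b) ≡ false → b ≤ a
<ᵇ-false e = ≮⇒≥ (λ a<b → subst IsTrue e (<⇒<ᵇ a<b))

≡ᵇ-true : ∀ {a b} → (a ≡ᵇ b) ≡ true → a ≡ b
≡ᵇ-true {a} {b} e = ≡ᵇ⇒≡ a b (subst IsTrue (sym e) tt)

≡ᵇ-false : ∀ {a b} → (a ≡ᵇ b) ≡ false → a ≢ b
≡ᵇ-false {a} {b} e q = subst IsTrue e (≡⇒≡ᵇ a b q)

no-between : ∀ {k e} → k < e → e < suc k → ⊥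
no-between k<e e<sk = <-irrefl refl (<-≤-trans k<e (≤-pred e<sk))

entryAt-< : ∀ xs c {v} → entryAt xs c ≡ just v → c < length xs
entryAt-< (x ∷ xs) zero    e = s≤s z≤n
entryAt-< (x ∷ xs) (suc c) e = s≤s (entryAt-< xs c e)

entryAt-exists : ∀ xs c → c < length xs → Σ ℕ λ v → entryAt xs c ≡ just v
entryAt-exists (x ∷ xs) zero    _       = x , refl
entryAt-exists (x ∷ xs) (suc c) (s≤s p) = entryAt-exists xs c p

length-setAt : ∀ xs c y → length (setAt xs c y) ≡ length xs
length-setAt []       c       y = refl
length-setAt (x ∷ xs) zero    y = refl
length-setAt (x ∷ xs) (suc c) y = cong suc (length-setAt xs c y)

entryAt-setAt-same : ∀ xs c y → c < length xs → entryAt (setAt xs c y) c ≡ just y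
entryAt-setAt-same (x ∷ xs) zero    y _       = refl
entryAt-setAt-same (x ∷ xs) (suc c) y (s≤s p) = entryAt-setAt-same xs c y p

entryAt-setAt-other : ∀ xs c y c' → c' ≢ c → entryAt (setAt xs c y) c' ≡ entryAt xs c'
entryAt-setAt-other []       c       y c'       ne = refl
entryAt-setAt-other (x ∷ xs) zero    y zero     ne = ⊥-elim (ne refl)
entryAt-setAt-other (x ∷ xs) zero    y (suc c') ne = refl
entryAt-setAt-other (x ∷ xs) (suc c) y zero     ne = refl
entryAt-setAt-other (x ∷ xs) (suc c) y (suc c') ne = entryAt-setAt-other xs c y c' (ne ∘ cong suc)

length-snoc : ∀ (xs : List ℕ) k → length (xs ++ k ∷ []) ≡ suc (length xs)
length-snoc xs k = trans (length-++ xs) (+-comm (length xs) 1)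

entryAt-snoc-new : ∀ xs k → entryAt (xs ++ k ∷ []) (length xs) ≡ just k
entryAt-snoc-new []       k = refl
entryAt-snoc-new (x ∷ xs) k = entryAt-snoc-new xs k

entryAt-snoc-old : ∀ xs k c {v} → entryAt xs c ≡ just v → entryAt (xs ++ k ∷ []) c ≡ just v
entryAt-snoc-old (x ∷ xs) k zero    e = e
entryAt-snoc-old (x ∷ xs) k (suc c) e = entryAt-snoc-old xs k c e

entryAt-snoc-inv : ∀ xs k c {v} → entryAt (xs ++ k ∷ []) c ≡ just v →
  (entryAt xs c ≡ just v) ⊎ (c ≡ length xs × v ≡ k)
entryAt-snoc-inv []       k zero    e = inj₂ (refl , just-injective (sym e))
entryAt-snoc-inv (x ∷ xs) k zero    e = inj₁ e
entryAt-snoc-inv (x ∷ xs) k (suc c) e with entryAt-snoc-inv xs k c e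
... | inj₁ p       = inj₁ p
... | inj₂ (p , q) = inj₂ (cong suc p , q)

rowAt : Tab → ℕ → List ℕ
rowAt []       _       = []
rowAt (r ∷ _)  zero    = r
rowAt (_ ∷ rs) (suc i) = rowAt rs i

get : Tab → ℕ → ℕ → Maybe ℕ
get T i c = entryAt (rowAt T i) c

lenR : Tab → ℕ → ℕ
lenR T i = length (rowAt T i)

InCol : Tab → ℕ → ℕ → Set
InCol T c v = Σ ℕ λ i → get T i c ≡ just v

InT : Tab → ℕ → Set
InT T v = Σ ℕ λ c → InCol T c v

get-< : ∀ T i c {v} → get T i c ≡ just v → c < lenR T i
get-< T i c = entryAt-< (rowAt T i) c

get-exists : ∀ T i c → c < lenR T i → Σ ℕ λ v → get T i c ≡ just v
get-exists T i c = entryAt-exists (rowAt T i) c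

rowAt-append-same : ∀ i k T → rowAt (appendRow i k T) i ≡ rowAt T i ++ k ∷ []
rowAt-append-same zero    k []         = refl
rowAt-append-same zero    k (row ∷ rs) = refl
rowAt-append-same (suc i) k []         = rowAt-append-same i k []
rowAt-append-same (suc i) k (row ∷ rs) = rowAt-append-same i k rs

rowAt-append-other : ∀ i k T i' → i' ≢ i → rowAt (appendRow i k T) i' ≡ rowAt T i'
rowAt-append-other zero    k []         zero     ne = ⊥-elim (ne refl)
rowAt-append-other zero    k []         (suc i') ne = refl
rowAt-append-other zero    k (row ∷ rs) zero     ne = ⊥-elim (ne refl)
rowAt-append-other zero    k (row ∷ rs) (suc i') ne = refl
rowAt-append-other (suc i) k []         zero     ne = refl
rowAt-append-other (suc i) k []         (suc i') ne = rowAt-append-other i k [] i' (ne ∘ cong suc)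
rowAt-append-other (suc i) k (row ∷ rs) zero     ne = refl
rowAt-append-other (suc i) k (row ∷ rs) (suc i') ne = rowAt-append-other i k rs i' (ne ∘ cong suc)

module Append (i0 k : ℕ) (T : Tab) where
  T⁺ : Tab
  T⁺ = appendRow i0 k T

  len-same : lenR T⁺ i0 ≡ suc (lenR T i0)
  len-same = trans (cong length (rowAt-append-same i0 k T)) (length-snoc (rowAt T i0) k)

  len-other : ∀ i → i ≢ i0 → lenR T⁺ i ≡ lenR T i
  len-other i ne = cong length (rowAt-append-other i0 k T i ne)

  get-old : ∀ i c {v} → get T i c ≡ just v → get T⁺ i c ≡ just v
  get-old i c e with i ≟ i0
  ... | yes refl = trans (cong (λ z → entryAt z c) (rowAt-append-same i0 k T)) (entryAt-snoc-old (rowAt T i0) k c e)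
  ... | no ne    = trans (cong (λ z → entryAt z c) (rowAt-append-other i0 k T i ne)) e

  get-new : get T⁺ i0 (lenR T i0) ≡ just k
  get-new = trans (cong (λ z → entryAt z (lenR T i0)) (rowAt-append-same i0 k T)) (entryAt-snoc-new (rowAt T i0) k)

  get-inv : ∀ i c {v} → get T⁺ i c ≡ just v → get T i c ≡ just v ⊎ (i ≡ i0 × c ≡ lenR T i0 × v ≡ k)
  get-inv i c e with i ≟ i0
  ... | no ne = inj₁ (trans (cong (λ z → entryAt z c) (sym (rowAt-append-other i0 k T i ne))) e)
  ... | yes refl with entryAt-snoc-inv (rowAt T i0) k c (trans (sym (cong (λ z → entryAt z c) (rowAt-append-same i0 k T))) e)
  ...   | inj₁ p       = inj₁ p
  ...   | inj₂ (p , q) = inj₂ (refl , p , q)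

removeLastL-just : ∀ xs {y ys} → removeLastL xs ≡ just (y , ys) → xs ≡ ys ++ y ∷ []
removeLastL-just (x ∷ []) refl = refl
removeLastL-just (x ∷ xs@(_ ∷ _)) e with removeLastL xs in eq
removeLastL-just (x ∷ xs@(_ ∷ _)) refl | just (y' , xs') = cong (x ∷_) (removeLastL-just xs eq)

removeLastL-exists : ∀ x xs → Σ ℕ λ y → Σ (List ℕ) λ ys → removeLastL (x ∷ xs) ≡ just (y , ys)
removeLastL-exists x [] = x , [] , refl
removeLastL-exists x (x' ∷ xs) with removeLastL (x' ∷ xs) | removeLastL-exists x' xs
... | just (y , ys) | _ = y , x ∷ ys , refl
... | nothing | (_ , _ , ())

record Removed (i : ℕ) (T : Tab) (y c : ℕ) (T' : Tab) : Set where
  field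
    row-same  : rowAt T i ≡ rowAt T' i ++ y ∷ []
    col-last  : c ≡ length (rowAt T' i)
    row-other : ∀ i' → i' ≢ i → rowAt T' i' ≡ rowAt T i'

removeLastRow-spec : ∀ i T {y c T'} → removeLastRow i T ≡ just (y , c , T') → Removed i T y c T'
removeLastRow-spec zero (row ∷ rs) e with removeLastL row in eq
removeLastRow-spec zero (row ∷ rs) refl | just (y , row') = record
  { row-same = removeLastL-just row eq ; col-last = refl
  ; row-other = λ { zero ne → ⊥-elim (ne refl) ; (suc i') ne → refl } }
removeLastRow-spec (suc i) (row ∷ rs) e with removeLastRow i rs in eq
removeLastRow-spec (suc i) (row ∷ rs) refl | just (y , c , rs') =
  let s = removeLastRow-spec i rs eq in record
  { row-same = Removed.row-same s ; col-last = Removed.col-last s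
  ; row-other = λ { zero ne → refl ; (suc i') ne → Removed.row-other s i' (ne ∘ cong suc) } }

removeLastRow-exists : ∀ i T → 0 < lenR T i → Σ ℕ λ y → Σ ℕ λ c → Σ Tab λ T' → removeLastRow i T ≡ just (y , c , T')
removeLastRow-exists zero (row ∷ rs) p with row
... | x ∷ xs with removeLastL (x ∷ xs) | removeLastL-exists x xs
...   | just (y , ys) | _ = y , length ys , ys ∷ rs , refl
...   | nothing | (_ , _ , ())
removeLastRow-exists (suc i) (row ∷ rs) p with removeLastRow i rs | removeLastRow-exists i rs p
... | just (y , c , rs') | _ = y , c , row ∷ rs' , refl
... | nothing | (_ , _ , _ , ())

module RemovedFacts {i0 T y c T'} (s : Removed i0 T y c T') where
  open Removed s

  len-same : lenR T' i0 ≡ c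
  len-same = sym col-last

  len-before : lenR T i0 ≡ suc c
  len-before = trans (cong length row-same) (trans (length-snoc (rowAt T' i0) y) (cong suc (sym col-last)))

  len-other : ∀ i → i ≢ i0 → lenR T' i ≡ lenR T i
  len-other i ne = cong length (row-other i ne)

  get-removed : get T i0 c ≡ just y
  get-removed = trans (cong (λ z → entryAt z c) row-same)
    (subst (λ cc → entryAt (rowAt T' i0 ++ y ∷ []) cc ≡ just y) (sym col-last) (entryAt-snoc-new (rowAt T' i0) y))

  get-kept : ∀ i c' {v} → get T' i c' ≡ just v → get T i c' ≡ just v
  get-kept i c' e with i ≟ i0
  ... | yes refl = trans (cong (λ z → entryAt z c') row-same) (entryAt-snoc-old (rowAt T' i0) y c' e)
  ... | no ne    = trans (cong (λ z → entryAt z c') (sym (row-other i ne))) e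

  get-back : ∀ i c' {v} → get T i c' ≡ just v → (i ≡ i0 × c' ≡ c × v ≡ y) ⊎ get T' i c' ≡ just v
  get-back i c' e with i ≟ i0
  ... | no ne = inj₂ (trans (cong (λ z → entryAt z c') (row-other i ne)) e)
  ... | yes refl with entryAt-snoc-inv (rowAt T' i0) y c' (trans (sym (cong (λ z → entryAt z c') row-same)) e)
  ...   | inj₁ p       = inj₂ p
  ...   | inj₂ (p , q) = inj₁ (refl , trans p (sym col-last) , q)

record Updated (T : Tab) (r c y : ℕ) (T' : Tab) : Set where
  field
    row-same  : rowAt T' r ≡ setAt (rowAt T r) c y
    row-other : ∀ i → i ≢ r → rowAt T' i ≡ rowAt T i

module UpdatedFacts {T r c y T'} (u : Updated T r c y T') where
  open Updated u

  len-all : ∀ i → lenR T' i ≡ lenR T i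
  len-all i with i ≟ r
  ... | yes refl = trans (cong length row-same) (length-setAt (rowAt T r) c y)
  ... | no ne    = cong length (row-other i ne)

  get-same : c < lenR T r → get T' r c ≡ just y
  get-same p = trans (cong (λ z → entryAt z c) row-same) (entryAt-setAt-same (rowAt T r) c y p)

  get-other : ∀ i c' → (i ≢ r ⊎ c' ≢ c) → get T' i c' ≡ get T i c'
  get-other i c' h with i ≟ r
  get-other i c' (inj₁ ne) | yes refl = ⊥-elim (ne refl)
  get-other i c' (inj₂ ne) | yes refl = trans (cong (λ z → entryAt z c') row-same) (entryAt-setAt-other (rowAt T r) c y c' ne)
  ... | no ne = cong (λ z → entryAt z c') (row-other i ne)

  get-inv : ∀ i c' {v} → get T' i c' ≡ just v → (i ≡ r × c' ≡ c × v ≡ y) ⊎ ((i ≢ r ⊎ c' ≢ c) × get T i c' ≡ just v)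
  get-inv i c' e with i ≟ r | c' ≟ c
  ... | yes refl | yes refl = inj₁ (refl , refl , just-injective (trans (sym e) (get-same (subst (c <_) (len-all r) (get-< T' r c e)))))
  ... | no ne    | _        = inj₂ (inj₁ ne , trans (sym (get-other i c' (inj₁ ne))) e)
  ... | yes _    | no ne    = inj₂ (inj₂ ne , trans (sym (get-other i c' (inj₂ ne))) e)

bumpCol-nothing : ∀ c y T → bumpCol c y T ≡ nothing → ∀ r {e} → get T r c ≡ just e → y ≤ e
bumpCol-nothing c y (row ∷ rs) eq r ge with bumpCol c y rs in eq1
bumpCol-nothing c y (row ∷ rs) eq r ge | nothing with entryAt row c in eq2
bumpCol-nothing c y (row ∷ rs) eq (suc r) ge | nothing | nothing = bumpCol-nothing c y rs eq1 r ge
bumpCol-nothing c y (row ∷ rs) eq zero ge | nothing | nothing = ⊥-elim (just≢nothing (trans (sym ge) eq2))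
bumpCol-nothing c y (row ∷ rs) eq r ge | nothing | just e with e <ᵇ y in eq3
bumpCol-nothing c y (row ∷ rs) eq (suc r) ge | nothing | just e | false = bumpCol-nothing c y rs eq1 r ge
bumpCol-nothing c y (row ∷ rs) eq zero ge | nothing | just e | false
  rewrite just-injective (trans (sym ge) eq2) = <ᵇ-false eq3

record Bumped (c y : ℕ) (T : Tab) (z : ℕ) (T' : Tab) : Set where
  field
    row     : ℕ
    get-z   : get T row c ≡ just z
    z<y     : z < y
    lowest  : ∀ r' {e} → row < r' → get T r' c ≡ just e → y ≤ e
    updated : Updated T row c y T'

bumpCol-just : ∀ c y T {z T'} → bumpCol c y T ≡ just (z , T') → Bumped c y T z T'
bumpCol-just c y (row ∷ rs) eq with bumpCol c y rs in eq1
bumpCol-just c y (row ∷ rs) refl | just (x , rs') = let s = bumpCol-just c y rs eq1 in record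
  { row = suc (Bumped.row s) ; get-z = Bumped.get-z s ; z<y = Bumped.z<y s
  ; lowest = λ { zero () ; (suc r') (s≤s lt) ge → Bumped.lowest s r' lt ge }
  ; updated = record
      { row-same  = Updated.row-same (Bumped.updated s)
      ; row-other = λ { zero ne → refl ; (suc i) ne → Updated.row-other (Bumped.updated s) i (ne ∘ cong suc) } } }
bumpCol-just c y (row ∷ rs) eq | nothing with entryAt row c in eq2
bumpCol-just c y (row ∷ rs) eq | nothing | just e with e <ᵇ y in eq3
bumpCol-just c y (row ∷ rs) refl | nothing | just e | true = record
  { row = zero ; get-z = eq2 ; z<y = <ᵇ-true eq3
  ; lowest = λ { (suc r') _ ge → bumpCol-nothing c y rs eq1 r' ge }
  ; updated = record { row-same = refl ; row-other = λ { zero ne → ⊥-elim (ne refl) ; (suc i) ne → refl } } }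

record IsTab (T : Tab) : Set where
  field
    lenDec   : ∀ i → lenR T (suc i) ≤ lenR T i
    rowInc   : ∀ {i c c' a b} → get T i c ≡ just a → get T i c' ≡ just b → c < c' → a < b
    colInc   : ∀ {i i' c a b} → get T i c ≡ just a → get T i' c ≡ just b → i < i' → a < b
    distinct : ∀ {i i' c c' v} → get T i c ≡ just v → get T i' c' ≡ just v → (i ≡ i') × (c ≡ c')

module TabLemmas {T : Tab} (tb : IsTab T) where
  open IsTab tb

  lenMono : ∀ {i j} → i ≤ j → lenR T j ≤ lenR T i
  lenMono {i} {j} p with m≤n⇒m<n∨m≡n p
  ... | inj₂ refl = ≤-refl
  lenMono {i} {suc j} p | inj₁ (s≤s q) = ≤-trans (lenDec j) (lenMono q)

  cornerMax : ∀ {i c y} → get T i c ≡ just y → lenR T (suc i) ≤ c → ∀ {i' e} → get T i' c ≡ just e → e ≤ y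
  cornerMax {i} {c} {y} g h {i'} {e} g' with <-cmp i' i
  ... | tri< lt _ _   = <⇒≤ (colInc g' g lt)
  ... | tri≈ _ refl _ = ≤-reflexive (just-injective (trans (sym g') g))
  ... | tri> _ _ gt   = ⊥-elim (<-irrefl refl (<-≤-trans (get-< T i' c g') (≤-trans (lenMono gt) h)))

  -- if k+1 lies in a lower row than k, it lies weakly to the left of k
  -- (otherwise the entry of row i above k+1 would lie strictly between k and k+1)
  succBelow⇒weaklyLeft : ∀ {k i c j d} → get T i c ≡ just k → get T j d ≡ just (suc k) → i < j → d ≤ c
  succBelow⇒weaklyLeft {k} {i} {c} {j} {d} g1 g2 i<j with d ≤? c
  ... | yes p = p
  ... | no np =
    let (e , ge) = get-exists T i d (<-≤-trans (get-< T j d g2) (lenMono (<⇒≤ i<j)))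
    in ⊥-elim (no-between (rowInc g1 ge (≰⇒> np)) (colInc ge g2 i<j))

  succWeaklyAbove⇒right : ∀ {k i c j d} → get T i c ≡ just k → get T j d ≡ just (suc k) → j ≤ i → c < d
  succWeaklyAbove⇒right {k} {i} {c} {j} {d} g1 g2 j≤i with c <? d
  ... | yes p = p
  ... | no np with m≤n⇒m<n∨m≡n (≮⇒≥ np) | m≤n⇒m<n∨m≡n j≤i
  ...   | inj₂ refl | inj₁ j<i  = ⊥-elim (<-asym (colInc g2 g1 j<i) (n<1+n k))
  ...   | inj₂ refl | inj₂ refl = ⊥-elim (<-irrefl (just-injective (trans (sym g1) g2)) (n<1+n k))
  ...   | inj₁ d<c  | inj₂ refl = ⊥-elim (<-asym (rowInc g2 g1 d<c) (n<1+n k))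
  ...   | inj₁ d<c  | inj₁ j<i  =
    let (e , ge) = get-exists T j c (<-≤-trans (get-< T i c g1) (lenMono (<⇒≤ j<i)))
    in ⊥-elim (<-asym (colInc ge g1 j<i) (<-trans (n<1+n k) (rowInc g2 ge d<c)))

-- Column deletion at the corner (i0 , c1) of T0 removes the corner letter
-- Y c1 and then, for c = c1, c1-1, …, 1, bumps the carried letter Y c into
-- column c-1, ejecting Y (c-1) = the largest entry of column c-1 of T0 below
-- Y c.  BumpState T0 i0 c1 c y r Tc describes the tableau Tc reached when the
-- letter y = Y c is carried (it came from row r of column c): Tc is a
-- tableau of the expected shape, and column by column it is T0 with the
-- chain Y shifted one column to the left.

record BumpState (T0 : Tab) (i0 c1 : ℕ) (c y r : ℕ) (Tc : Tab) : Set where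
  field
    isTab     : IsTab Tc
    lenCorner : lenR Tc i0 ≡ c1
    lenOther  : ∀ ρ → ρ ≢ i0 → lenR Tc ρ ≡ lenR T0 ρ
    fresh     : ∀ ρ c' → get Tc ρ c' ≢ just y
    -- the next bump succeeds: left of row r there is an entry smaller than y
    pivot     : ∀ c0 → c ≡ suc c0 → Σ ℕ λ e → get Tc r c0 ≡ just e × e < y
    bigger    : ∀ {ρ c' e} → r ≤ ρ → c ≤ c' → get Tc ρ c' ≡ just e → y < e
    Y             : ℕ → ℕ
    chainAt       : Y c ≡ y
    col≤          : c ≤ c1
    cornerIn      : InCol T0 c1 (Y c1)
    cornerLargest : ∀ e → InCol T0 c1 e → e ≤ Y c1
    chainIn       : ∀ c'' → c ≤ c'' → c'' < c1 → InCol T0 c'' (Y c'')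
    chainInc      : ∀ c'' → c ≤ c'' → c'' < c1 → Y c'' < Y (suc c'')
    chainLargest  : ∀ c'' → c ≤ c'' → c'' < c1 → ∀ e → InCol T0 c'' e → e < Y (suc c'') → e ≤ Y c''
    leftSub : ∀ c'' v → c'' < c → InCol Tc c'' v → InCol T0 c'' v
    leftSup : ∀ c'' v → c'' < c → InCol T0 c'' v → InCol Tc c'' v
    midSub   : ∀ c'' v → c ≤ c'' → c'' < c1 → InCol Tc c'' v → (InCol T0 c'' v × v ≢ Y c'') ⊎ v ≡ Y (suc c'')
    midSup   : ∀ c'' v → c ≤ c'' → c'' < c1 → InCol T0 c'' v → v ≢ Y c'' → InCol Tc c'' v
    midChain : ∀ c'' → c ≤ c'' → c'' < c1 → InCol Tc c'' (Y (suc c''))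
    cornerColSub : ∀ v → InCol Tc c1 v → InCol T0 c1 v × v ≢ Y c1
    cornerColSup : ∀ v → InCol T0 c1 v → v ≢ Y c1 → InCol Tc c1 v
    rightSub : ∀ c'' v → c1 < c'' → InCol Tc c'' v → InCol T0 c'' v
    rightSup : ∀ c'' v → c1 < c'' → InCol T0 c'' v → InCol Tc c'' v

-- equality of naturals decided as a sum: case splits on it leave the
-- `with` inside setChain untouched, unlike splits on `_≟_`
≡-or-≢ : (a b : ℕ) → (a ≡ b) ⊎ (a ≢ b)
≡-or-≢ a b with a ≟ b
... | yes p = inj₁ p
... | no p  = inj₂ p

setChain : (ℕ → ℕ) → ℕ → ℕ → ℕ → ℕ
setChain Y c0 z n with n ≟ c0
... | yes _ = z
... | no _  = Y n

setChain-same : ∀ Y c0 z → setChain Y c0 z c0 ≡ z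
setChain-same Y c0 z with c0 ≟ c0
... | yes _ = refl
... | no ne = ⊥-elim (ne refl)

setChain-other : ∀ Y c0 z n → n ≢ c0 → setChain Y c0 z n ≡ Y n
setChain-other Y c0 z n ne with n ≟ c0
... | yes e = ⊥-elim (ne e)
... | no _  = refl

module BumpStart {T0 : Tab} (tb0 : IsTab T0) {i0 y c1 Tr} (rs : Removed i0 T0 y c1 Tr)
                 (corner : lenR T0 (suc i0) ≤ c1) where
  open IsTab tb0
  open TabLemmas tb0
  module R = RemovedFacts rs

  lenTr : ∀ ρ → lenR Tr ρ ≤ lenR T0 ρ
  lenTr ρ with ρ ≟ i0
  ... | yes refl = ≤-trans (≤-reflexive R.len-same) (≤-trans (n≤1+n c1) (≤-reflexive (sym R.len-before)))
  ... | no ne    = ≤-reflexive (R.len-other ρ ne)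

  tabTr : IsTab Tr
  tabTr = record
    { lenDec   = lenDec'
    ; rowInc   = λ g1 g2 lt → rowInc (R.get-kept _ _ g1) (R.get-kept _ _ g2) lt
    ; colInc   = λ g1 g2 lt → colInc (R.get-kept _ _ g1) (R.get-kept _ _ g2) lt
    ; distinct = λ g1 g2 → distinct (R.get-kept _ _ g1) (R.get-kept _ _ g2) }
    where
    lenDec' : ∀ i → lenR Tr (suc i) ≤ lenR Tr i
    lenDec' i with i ≟ i0
    ... | yes refl = ≤-trans (lenTr (suc i0)) (≤-trans corner (≤-reflexive (sym R.len-same)))
    ... | no ne    = ≤-trans (lenTr (suc i)) (≤-trans (lenDec i) (≤-reflexive (sym (R.len-other i ne))))

  freshTr : ∀ ρ c' → get Tr ρ c' ≢ just y
  freshTr ρ c' g with distinct (R.get-kept ρ c' g) R.get-removed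
  ... | refl , refl = <-irrefl refl (subst (c' <_) R.len-same (get-< Tr ρ c' g))

  noneBelowRight : ∀ ρ c' {e} → i0 ≤ ρ → c1 ≤ c' → get Tr ρ c' ≡ just e → ⊥
  noneBelowRight ρ c' r≤ρ c≤c' g with m≤n⇒m<n∨m≡n r≤ρ
  ... | inj₂ refl = <-irrefl refl (<-≤-trans (get-< Tr ρ c' g) (≤-trans (≤-reflexive R.len-same) c≤c'))
  ... | inj₁ lt   = <-irrefl refl (<-≤-trans (get-< Tr ρ c' g)
                      (≤-trans (lenTr ρ) (≤-trans (lenMono lt) (≤-trans corner c≤c'))))

  kept : ∀ c'' v → c'' ≢ c1 → InCol T0 c'' v → InCol Tr c'' v
  kept c'' v ne (i , g) with R.get-back i c'' g
  ... | inj₁ (_ , e , _) = ⊥-elim (ne e)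
  ... | inj₂ g'          = i , g'

  keptCorner : ∀ v → InCol T0 c1 v → v ≢ y → InCol Tr c1 v
  keptCorner v (i , g) ne with R.get-back i c1 g
  ... | inj₁ (_ , _ , e) = ⊥-elim (ne e)
  ... | inj₂ g'          = i , g'

  empty : ∀ {c''} → c1 ≤ c'' → c'' < c1 → ⊥
  empty a b = <-irrefl refl (<-≤-trans b a)

  init : BumpState T0 i0 c1 c1 y i0 Tr
  init = record
    { isTab = tabTr
    ; lenCorner = R.len-same
    ; lenOther = R.len-other
    ; fresh = freshTr
    ; pivot = λ c0 eq →
        let c0<c1 = subst (c0 <_) (sym eq) (n<1+n c0)
            (e , ge) = get-exists Tr i0 c0 (subst (c0 <_) (sym R.len-same) c0<c1)
        in e , ge , rowInc (R.get-kept i0 c0 ge) R.get-removed c0<c1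
    ; bigger = λ r≤ρ c≤c' g → ⊥-elim (noneBelowRight _ _ r≤ρ c≤c' g)
    ; Y = λ _ → y
    ; chainAt = refl
    ; col≤ = ≤-refl
    ; cornerIn = i0 , R.get-removed
    ; cornerLargest = λ e (i , g) → cornerMax R.get-removed corner g
    ; chainIn = λ c'' a b → ⊥-elim (empty a b)
    ; chainInc = λ c'' a b → ⊥-elim (empty a b)
    ; chainLargest = λ c'' a b → ⊥-elim (empty a b)
    ; leftSub = λ c'' v lt (i , g) → i , R.get-kept i c'' g
    ; leftSup = λ c'' v lt → kept c'' v (λ e → <-irrefl e lt)
    ; midSub = λ c'' v a b → ⊥-elim (empty a b)
    ; midSup = λ c'' v a b → ⊥-elim (empty a b)
    ; midChain = λ c'' a b → ⊥-elim (empty a b)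
    ; cornerColSub = λ v (i , g) → (i , R.get-kept i c1 g) , (λ { refl → freshTr i c1 g })
    ; cornerColSup = keptCorner
    ; rightSub = λ c'' v lt (i , g) → i , R.get-kept i c'' g
    ; rightSup = λ c'' v lt → kept c'' v (λ e → <-irrefl (sym e) lt) }

module BumpStep {T0 : Tab} {i0 c1 c0 y r' Tc z Tc'}
                (I : BumpState T0 i0 c1 (suc c0) y r' Tc) (B : Bumped c0 y Tc z Tc') where
  open BumpState I
  open Bumped B renaming (row to r)
  open IsTab isTab
  module U = UpdatedFacts updated

  r'≤r : r' ≤ r
  r'≤r with pivot c0 refl
  ... | (e , ge , e<y) = ≮⇒≥ (λ r<r' → <-irrefl refl (<-≤-trans e<y (lowest r' r<r' ge)))

  c0<len : c0 < lenR Tc r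
  c0<len = get-< Tc r c0 get-z

  c0<c1 : c0 < c1
  c0<c1 = col≤

  colBack : ∀ c' v → c' ≢ c0 → InCol Tc' c' v → InCol Tc c' v
  colBack c' v ne (i , g) = i , trans (sym (U.get-other i c' (inj₂ ne))) g

  colForth : ∀ c' v → c' ≢ c0 → InCol Tc c' v → InCol Tc' c' v
  colForth c' v ne (i , g) = i , trans (U.get-other i c' (inj₂ ne)) g

  Y' : ℕ → ℕ
  Y' = setChain Y c0 z

  Y'-other : ∀ n → n ≢ c0 → Y' n ≡ Y n
  Y'-other = setChain-other Y c0 z

  Y'-c0 : Y' c0 ≡ z
  Y'-c0 = setChain-same Y c0 z

  Y'-suc : ∀ {c''} → c0 ≤ c'' → Y' (suc c'') ≡ Y (suc c'')
  Y'-suc a = Y'-other _ (λ q → <-irrefl (sym q) (s≤s a))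

  Y'-y : Y' (suc c0) ≡ y
  Y'-y = trans (Y'-suc ≤-refl) chainAt

  c1≢c0 : c1 ≢ c0
  c1≢c0 q = <-irrefl (sym q) c0<c1

  above : ∀ {c''} → c0 ≤ c'' → c'' ≢ c0 → suc c0 ≤ c''
  above a ne = ≤∧≢⇒< a (ne ∘ sym)

  tab' : IsTab Tc'
  tab' = record { lenDec = lenDec' ; rowInc = rowInc' ; colInc = colInc' ; distinct = distinct' }
    where
    lenDec' : ∀ i → lenR Tc' (suc i) ≤ lenR Tc' i
    lenDec' i = subst₂ _≤_ (sym (U.len-all (suc i))) (sym (U.len-all i)) (lenDec i)
    rowInc' : ∀ {i a b va vb} → get Tc' i a ≡ just va → get Tc' i b ≡ just vb → a < b → va < vb
    rowInc' {i} {a} {b} g1 g2 lt with U.get-inv i a g1 | U.get-inv i b g2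
    ... | inj₁ (refl , refl , refl) | inj₁ (_ , refl , _)    = ⊥-elim (<-irrefl refl lt)
    ... | inj₁ (refl , refl , refl) | inj₂ (_ , g2')         = bigger r'≤r lt g2'
    ... | inj₂ (_ , g1')            | inj₁ (refl , refl , refl) = <-trans (rowInc g1' get-z lt) z<y
    ... | inj₂ (_ , g1')            | inj₂ (_ , g2')         = rowInc g1' g2' lt
    colInc' : ∀ {i i' cc va vb} → get Tc' i cc ≡ just va → get Tc' i' cc ≡ just vb → i < i' → va < vb
    colInc' {i} {i'} {cc} g1 g2 lt with U.get-inv i cc g1 | U.get-inv i' cc g2
    ... | inj₁ (refl , refl , refl) | inj₁ (refl , _ , _)    = ⊥-elim (<-irrefl refl lt)
    ... | inj₁ (refl , refl , refl) | inj₂ (_ , g2')         =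
          ≤∧≢⇒< (lowest i' lt g2') (λ e → fresh i' c0 (trans g2' (cong just (sym e))))
    ... | inj₂ (_ , g1')            | inj₁ (refl , refl , refl) = <-trans (colInc g1' get-z lt) z<y
    ... | inj₂ (_ , g1')            | inj₂ (_ , g2')         = colInc g1' g2' lt
    distinct' : ∀ {i i' a b v} → get Tc' i a ≡ just v → get Tc' i' b ≡ just v → (i ≡ i') × (a ≡ b)
    distinct' {i} {i'} {a} {b} g1 g2 with U.get-inv i a g1 | U.get-inv i' b g2
    ... | inj₁ (refl , refl , refl) | inj₁ (refl , refl , _) = refl , refl
    ... | inj₁ (refl , refl , refl) | inj₂ (_ , g2')         = ⊥-elim (fresh i' b g2')
    ... | inj₂ (_ , g1')            | inj₁ (refl , refl , refl) = ⊥-elim (fresh i a g1')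
    ... | inj₂ (_ , g1')            | inj₂ (_ , g2')         = distinct g1' g2'

  fresh' : ∀ ρ c' → get Tc' ρ c' ≢ just z
  fresh' ρ c' g with U.get-inv ρ c' g
  ... | inj₁ (_ , _ , e) = <-irrefl e z<y
  ... | inj₂ (ne , g') with distinct g' get-z
  ...   | refl , refl = [ (λ n → n refl) , (λ n → n refl) ]′ ne

  pivot' : ∀ c00 → c0 ≡ suc c00 → Σ ℕ λ e → get Tc' r c00 ≡ just e × e < z
  pivot' c00 refl =
    let (e , ge) = get-exists Tc r c00 (<-trans (n<1+n c00) c0<len)
    in e , trans (U.get-other r c00 (inj₂ (λ q → <-irrefl q (n<1+n c00)))) ge , rowInc ge get-z (n<1+n c00)

  bigger' : ∀ {ρ c' e} → r ≤ ρ → c0 ≤ c' → get Tc' ρ c' ≡ just e → z < e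
  bigger' {ρ} {c'} r≤ρ c0≤c' g with U.get-inv ρ c' g
  ... | inj₁ (_ , _ , refl) = z<y
  ... | inj₂ (ne , g') with m≤n⇒m<n∨m≡n c0≤c'
  ...   | inj₁ lt = <-trans z<y (bigger (≤-trans r'≤r r≤ρ) lt g')
  ...   | inj₂ refl = colInc get-z g' (≤∧≢⇒< r≤ρ (λ q → [ (λ n → n (sym q)) , (λ n → n refl) ]′ ne))

  zIn : InCol T0 c0 z
  zIn = leftSub c0 z (n<1+n c0) (r , get-z)

  zLargest : ∀ e → InCol T0 c0 e → e < y → e ≤ z
  zLargest e ic e<y with leftSup c0 e (n<1+n c0) ic
  ... | (ρ , g) with <-cmp ρ r
  ...   | tri< lt _ _   = <⇒≤ (colInc g get-z lt)
  ...   | tri≈ _ refl _ = ≤-reflexive (just-injective (trans (sym g) get-z))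
  ...   | tri> _ _ gt   = ⊥-elim (<-irrefl refl (<-≤-trans e<y (lowest ρ gt g)))

  chainIn' : ∀ c'' → c0 ≤ c'' → c'' < c1 → InCol T0 c'' (Y' c'')
  chainIn' c'' a b with ≡-or-≢ c'' c0
  ... | inj₁ refl = subst (InCol T0 c0) (sym Y'-c0) zIn
  ... | inj₂ ne = subst (InCol T0 c'') (sym (Y'-other c'' ne)) (chainIn c'' (above a ne) b)

  chainInc' : ∀ c'' → c0 ≤ c'' → c'' < c1 → Y' c'' < Y' (suc c'')
  chainInc' c'' a b with ≡-or-≢ c'' c0
  ... | inj₁ refl = subst₂ _<_ (sym Y'-c0) (sym Y'-y) z<y
  ... | inj₂ ne = subst₂ _<_ (sym (Y'-other c'' ne)) (sym (Y'-suc a)) (chainInc c'' (above a ne) b)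

  chainLargest' : ∀ c'' → c0 ≤ c'' → c'' < c1 → ∀ e → InCol T0 c'' e → e < Y' (suc c'') → e ≤ Y' c''
  chainLargest' c'' a b e ic lt with ≡-or-≢ c'' c0
  ... | inj₁ refl = subst (e ≤_) (sym Y'-c0) (zLargest e ic (subst (e <_) Y'-y lt))
  ... | inj₂ ne = subst (e ≤_) (sym (Y'-other c'' ne))
                     (chainLargest c'' (above a ne) b e ic (subst (e <_) (Y'-suc a) lt))

  midSub' : ∀ c'' v → c0 ≤ c'' → c'' < c1 → InCol Tc' c'' v → (InCol T0 c'' v × v ≢ Y' c'') ⊎ v ≡ Y' (suc c'')
  midSub' c'' v a b (ρ , g) with ≡-or-≢ c'' c0
  ... | inj₁ refl with U.get-inv ρ c0 g
  ...   | inj₁ (_ , _ , refl) = inj₂ (sym Y'-y)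
  ...   | inj₂ (ne , g')      = inj₁ (leftSub c0 v (n<1+n c0) (ρ , g') , notZ)
    where
    notZ : v ≢ Y' c0
    notZ q with distinct g' (subst (λ w → get Tc r c0 ≡ just w) (sym (trans q Y'-c0)) get-z)
    ... | e1 , _ = [ (λ n → n e1) , (λ n → n refl) ]′ ne
  midSub' c'' v a b (ρ , g) | inj₂ ne with midSub c'' v (above a ne) b (colBack c'' v ne (ρ , g))
  ...   | inj₁ (ic , nv) = inj₁ (ic , subst (v ≢_) (sym (Y'-other c'' ne)) nv)
  ...   | inj₂ q         = inj₂ (trans q (sym (Y'-suc a)))

  midSup' : ∀ c'' v → c0 ≤ c'' → c'' < c1 → InCol T0 c'' v → v ≢ Y' c'' → InCol Tc' c'' v
  midSup' c'' v a b ic nv with ≡-or-≢ c'' c0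
  ... | inj₂ ne = colForth c'' v ne (midSup c'' v (above a ne) b ic (subst (v ≢_) (Y'-other c'' ne) nv))
  ... | inj₁ refl with leftSup c0 v (n<1+n c0) ic
  ...   | (ρ , g) with ρ ≟ r
  ...     | yes refl = ⊥-elim (nv (trans (just-injective (trans (sym g) get-z)) (sym Y'-c0)))
  ...     | no nr    = ρ , trans (U.get-other ρ c0 (inj₁ nr)) g

  midChain' : ∀ c'' → c0 ≤ c'' → c'' < c1 → InCol Tc' c'' (Y' (suc c''))
  midChain' c'' a b with ≡-or-≢ c'' c0
  ... | inj₁ refl = r , trans (U.get-same c0<len) (cong just (sym Y'-y))
  ... | inj₂ ne = subst (InCol Tc' c'') (sym (Y'-suc a)) (colForth c'' _ ne (midChain c'' (above a ne) b))

  step : BumpState T0 i0 c1 c0 z r Tc'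
  step = record
    { isTab = tab'
    ; lenCorner = trans (U.len-all i0) lenCorner
    ; lenOther = λ ρ ne → trans (U.len-all ρ) (lenOther ρ ne)
    ; fresh = fresh'
    ; pivot = pivot'
    ; bigger = bigger'
    ; Y = Y'
    ; chainAt = Y'-c0
    ; col≤ = <⇒≤ c0<c1
    ; cornerIn = subst (InCol T0 c1) (sym (Y'-other c1 c1≢c0)) cornerIn
    ; cornerLargest = λ e ic → subst (e ≤_) (sym (Y'-other c1 c1≢c0)) (cornerLargest e ic)
    ; chainIn = chainIn'
    ; chainInc = chainInc'
    ; chainLargest = chainLargest'
    ; leftSub = λ c'' v lt ic → leftSub c'' v (<-trans lt (n<1+n c0)) (colBack c'' v (λ q → <-irrefl q lt) ic)
    ; leftSup = λ c'' v lt ic → colForth c'' v (λ q → <-irrefl q lt) (leftSup c'' v (<-trans lt (n<1+n c0)) ic)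
    ; midSub = midSub'
    ; midSup = midSup'
    ; midChain = midChain'
    ; cornerColSub = λ v ic → subst (λ w → InCol T0 c1 v × v ≢ w) (sym (Y'-other c1 c1≢c0))
                                (cornerColSub v (colBack c1 v c1≢c0 ic))
    ; cornerColSup = λ v ic ne → colForth c1 v c1≢c0 (cornerColSup v ic (subst (v ≢_) (Y'-other c1 c1≢c0) ne))
    ; rightSub = λ c'' v lt ic → rightSub c'' v lt (colBack c'' v (λ q → <-irrefl (sym q) (<-trans c0<c1 lt)) ic)
    ; rightSup = λ c'' v lt ic → colForth c'' v (λ q → <-irrefl (sym q) (<-trans c0<c1 lt)) (rightSup c'' v lt ic) }

revBump-spec : ∀ {T0 i0 c1} c y r Tc → BumpState T0 i0 c1 c y r Tc →
  Σ ℕ λ r' → BumpState T0 i0 c1 0 (proj₁ (revBump c y Tc)) r' (proj₂ (revBump c y Tc))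
revBump-spec zero y r Tc I = r , I
revBump-spec (suc c) y r Tc I with bumpCol c y Tc in eq
... | just (z , Tc') = revBump-spec c z _ Tc' (BumpStep.step I (bumpCol-just c y Tc eq))
... | nothing with BumpState.pivot I c refl
...   | (e , ge , e<y) = ⊥-elim (<-irrefl refl (<-≤-trans e<y (bumpCol-nothing c y Tc eq r ge)))

colDelete-spec : ∀ {T0} → IsTab T0 → ∀ i0 c1 → lenR T0 i0 ≡ suc c1 → lenR T0 (suc i0) ≤ c1 →
  Σ ℕ λ r → BumpState T0 i0 c1 0 (proj₁ (colDelete i0 T0)) r (proj₂ (colDelete i0 T0))
colDelete-spec {T0} tb i0 c1 hl corner with removeLastRow i0 T0 in eq
... | just (y , c , Tr) with suc-injective (trans (sym hl) (RemovedFacts.len-before (removeLastRow-spec i0 T0 eq)))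
...   | refl = revBump-spec c y i0 Tr (BumpStart.init tb (removeLastRow-spec i0 T0 eq) corner)
colDelete-spec {T0} tb i0 c1 hl corner | nothing with removeLastRow-exists i0 T0 (subst (0 <_) (sym hl) z<s)
... | (_ , _ , _ , e) = ⊥-elim (just≢nothing (trans (sym e) eq))

downward : ∀ {n} (P : ℕ → Set) → P n → (∀ c → c < n → P (suc c) → P c) → ∀ c → c ≤ n → P c
downward {n} P top step c c≤n = go (n ∸ c) c (m+[n∸m]≡n c≤n)
  where
  go : ∀ d c → c + d ≡ n → P c
  go zero    c eq = subst P (sym (trans (sym (+-identityʳ c)) eq)) top
  go (suc d) c eq = step c (subst (c <_) eq (m<m+n c z<s)) (go d (suc c) (trans (sym (+-suc c d)) eq))

module Deletion {T0 i0 c1 x r T1} (tb0 : IsTab T0) (D : BumpState T0 i0 c1 0 x r T1) where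
  open BumpState D public

  colUnique : ∀ {a b v} → InCol T0 a v → InCol T0 b v → a ≡ b
  colUnique (i , g) (i' , g') = proj₂ (IsTab.distinct tb0 g g')

  chainCol : ∀ c → c ≤ c1 → InCol T0 c (Y c)
  chainCol c le with m≤n⇒m<n∨m≡n le
  ... | inj₁ lt   = chainIn c z≤n lt
  ... | inj₂ refl = cornerIn

  chainMono : ∀ {a} b → a < b → b ≤ c1 → Y a < Y b
  chainMono {a} (suc b) a<sb sb≤c1 with m≤n⇒m<n∨m≡n (≤-pred a<sb)
  ... | inj₂ refl = chainInc a z≤n sb≤c1
  ... | inj₁ a<b  = <-trans (chainMono b a<b (<⇒≤ sb≤c1)) (chainInc b z≤n sb≤c1)

  xY : x ≡ Y 0
  xY = sym chainAt

  -- where a letter v ≠ x of column c of T0 ends up in T1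
  data Moved (c v : ℕ) : Set where
    stays  : InCol T1 c v → (c ≤ c1 → v ≢ Y c) → Moved c v
    shifts : ∀ {c'} → c ≡ suc c' → c ≤ c1 → v ≡ Y c → InCol T1 c' v → Moved c v

  shiftChain : ∀ c → c ≤ c1 → Y c ≢ x → Moved c (Y c)
  shiftChain zero    le nx = ⊥-elim (nx chainAt)
  shiftChain (suc c) le nx = shifts refl le refl (midChain c z≤n le)

  move : ∀ c v → InCol T0 c v → v ≢ x → Moved c v
  move c v ic nx with <-cmp c c1
  ... | tri> _ _ gt = stays (rightSup c v gt ic) (λ le → ⊥-elim (<-irrefl refl (<-≤-trans gt le)))
  ... | tri≈ _ refl _ with v ≟ Y c1
  ...   | no ne    = stays (cornerColSup v ic ne) (λ _ → ne)
  ...   | yes refl = shiftChain c1 ≤-refl nx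
  move c v ic nx | tri< lt _ _ with v ≟ Y c
  ...   | no ne    = stays (midSup c v z≤n lt ic ne) (λ _ → ne)
  ...   | yes refl = shiftChain c (<⇒≤ lt) nx

  sub : ∀ c v → InCol T1 c v → InT T0 v
  sub c v ic with <-cmp c c1
  ... | tri> _ _ gt   = c , rightSub c v gt ic
  ... | tri≈ _ refl _ = c , proj₁ (cornerColSub v ic)
  ... | tri< lt _ _ with midSub c v z≤n lt ic
  ...   | inj₁ (ic' , _) = c , ic'
  ...   | inj₂ refl      = suc c , chainCol (suc c) lt

  chain-noSucc : ∀ {k p} → Y p ≡ k → p ≤ c1 → InCol T0 p (suc k) → ⊥
  chain-noSucc {k} {p} yp le ic with m≤n⇒m<n∨m≡n le
  ... | inj₂ refl = <-irrefl refl (subst (suc k ≤_) yp (cornerLargest (suc k) ic))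
  ... | inj₁ lt =
    let k<next = subst (_< Y (suc p)) yp (chainInc p z≤n lt)
        k+1≢next = λ q → <-irrefl (colUnique (subst (InCol T0 p) q ic) (chainCol (suc p) lt)) (n<1+n p)
    in <-irrefl refl (subst (suc k ≤_) yp (chainLargest p z≤n lt (suc k) ic (≤∧≢⇒< k<next k+1≢next)))

  chain-pred : ∀ {k p} → Y (suc p) ≡ suc k → suc p ≤ c1 → InCol T0 p k → Y p ≡ k
  chain-pred {k} {p} ys le ic =
    ≤-antisym (≤-pred (subst (Y p <_) ys (chainInc p z≤n le)))
              (chainLargest p z≤n le k ic (subst (k <_) (sym ys) (n<1+n k)))

  leftPair : ∀ {k p q} → InCol T0 p k → InCol T0 q (suc k) → q ≤ p →
    (x ≢ k) × (x ≢ suc k → Σ ℕ λ p' → Σ ℕ λ q' → InCol T1 p' k × InCol T1 q' (suc k) × q' ≤ p')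
  leftPair {k} {p} {q} ick ick1 q≤p = x≢k , survive
    where
    x≢k : x ≢ k
    x≢k xk with colUnique (chainCol 0 z≤n) (subst (InCol T0 p) (trans (sym xk) xY) ick)
    ... | refl = chain-noSucc (sym (trans (sym xk) xY)) z≤n (subst (λ w → InCol T0 w (suc k)) (n≤0⇒n≡0 q≤p) ick1)
    survive : x ≢ suc k → Σ ℕ λ p' → Σ ℕ λ q' → InCol T1 p' k × InCol T1 q' (suc k) × q' ≤ p'
    survive nx1 with move p k ick (x≢k ∘ sym) | move q (suc k) ick1 (nx1 ∘ sym)
    ... | stays a _ | stays b _ = p , q , a , b , q≤p
    ... | stays a _ | shifts {q'} refl _ _ b = p , q' , a , b , ≤-trans (n≤1+n q') q≤p
    ... | shifts {p'} refl ple yk a | stays b _ with m≤n⇒m<n∨m≡n q≤p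
    ...   | inj₁ lt   = p' , q , a , b , ≤-pred lt
    ...   | inj₂ refl = ⊥-elim (chain-noSucc (sym yk) ple ick1)
    survive nx1 | shifts refl ple yk a | shifts refl qle yk1 b with m≤n⇒m<n∨m≡n q≤p
    ... | inj₁ lt = ⊥-elim (<-asym (n<1+n k) (subst₂ _<_ (sym yk1) (sym yk) (chainMono _ lt ple)))
    ... | inj₂ eq = ⊥-elim (<-irrefl (trans (trans yk (cong Y (sym eq))) (sym yk1)) (n<1+n k))

  rightPair : ∀ {k p q} → InCol T0 p k → InCol T0 q (suc k) → p < q →
    (x ≢ suc k) × (x ≢ k → Σ ℕ λ p' → Σ ℕ λ q' → InCol T1 p' k × InCol T1 q' (suc k) × p' < q')
  rightPair {k} {p} {q} ick ick1 p<q = x≢k+1 , survive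
    where
    x≢k+1 : x ≢ suc k
    x≢k+1 xk with colUnique (chainCol 0 z≤n) (subst (InCol T0 q) (trans (sym xk) xY) ick1)
    ... | refl = n≮0 p<q
    survive : x ≢ k → Σ ℕ λ p' → Σ ℕ λ q' → InCol T1 p' k × InCol T1 q' (suc k) × p' < q'
    survive nx with move p k ick (nx ∘ sym) | move q (suc k) ick1 (x≢k+1 ∘ sym)
    ... | stays a _ | stays b _ = p , q , a , b , p<q
    ... | shifts {p'} refl _ _ a | stays b _ = p' , q , a , b , <-trans (n<1+n p') p<q
    ... | shifts {p'} refl _ _ a | shifts {q'} refl _ _ b = p' , q' , a , b , ≤-pred p<q
    ... | stays a nk | shifts {q'} refl qle yk1 b with m≤n⇒m<n∨m≡n (≤-pred p<q)
    ...   | inj₁ lt   = p , q' , a , b , lt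
    ...   | inj₂ refl = ⊥-elim (nk (≤-trans (n≤1+n p) qle) (sym (chain-pred (sym yk1) qle ick)))

-- Two successive column deletions, at corners in columns c1 and then c2:
-- the second ejected letter is smaller iff c1 ≤ c2, comparing the two chains
-- column by column from the right.
module TwoDeletions {T0 i0 c1 x r T1 j0 c2 x' r2 T2} (tb0 : IsTab T0)
                    (D1 : BumpState T0 i0 c1 0 x r T1) (D2 : BumpState T1 j0 c2 0 x' r2 T2) where
  module A = Deletion tb0 D1
  module B = Deletion (BumpState.isTab D1) D2

  ejected-decreases : c1 ≤ c2 → x' < x
  ejected-decreases le = subst₂ _<_ (sym B.xY) (sym A.xY) (downward (λ c → B.Y c < A.Y c) top step 0 z≤n)
    where
    top : B.Y c1 < A.Y c1
    top with A.cornerColSub (B.Y c1) (B.chainCol c1 le)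
    ... | (ic , ne) = ≤∧≢⇒< (A.cornerLargest _ ic) ne
    step : ∀ c → c < c1 → B.Y (suc c) < A.Y (suc c) → B.Y c < A.Y c
    step c c<c1 ih with A.midSub c (B.Y c) z≤n c<c1 (B.chainCol c (<⇒≤ (<-≤-trans c<c1 le)))
    ... | inj₁ (ic , ne) = ≤∧≢⇒< (A.chainLargest c z≤n c<c1 _ ic (<-trans (B.chainInc c z≤n (<-≤-trans c<c1 le)) ih)) ne
    ... | inj₂ q         = ⊥-elim (<-irrefl q (<-trans (B.chainInc c z≤n (<-≤-trans c<c1 le)) ih))

  ejected-increases : c2 < c1 → x < x'
  ejected-increases lt = subst₂ _<_ (sym A.xY) (sym B.xY) (downward (λ c → A.Y c < B.Y c) top step 0 z≤n)
    where
    top : A.Y c2 < B.Y c2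
    top = <-≤-trans (A.chainInc c2 z≤n lt) (B.cornerLargest _ (A.midChain c2 z≤n lt))
    step : ∀ c → c < c2 → A.Y (suc c) < B.Y (suc c) → A.Y c < B.Y c
    step c c<c2 ih = <-≤-trans (A.chainInc c z≤n (<-trans c<c2 lt))
                       (B.chainLargest c z≤n c<c2 _ (A.midChain c z≤n (<-trans c<c2 lt)) ih)

rowLen-add-same : ∀ i μ → rowLen (addBox i μ) i ≡ suc (rowLen μ i)
rowLen-add-same zero    []       = refl
rowLen-add-same zero    (a ∷ as) = refl
rowLen-add-same (suc i) []       = rowLen-add-same i []
rowLen-add-same (suc i) (a ∷ as) = rowLen-add-same i as

rowLen-add-other : ∀ i μ i' → i' ≢ i → rowLen (addBox i μ) i' ≡ rowLen μ i'
rowLen-add-other zero    []       zero     ne = ⊥-elim (ne refl)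
rowLen-add-other zero    []       (suc i') ne = refl
rowLen-add-other zero    (a ∷ as) zero     ne = ⊥-elim (ne refl)
rowLen-add-other zero    (a ∷ as) (suc i') ne = refl
rowLen-add-other (suc i) []       zero     ne = refl
rowLen-add-other (suc i) []       (suc i') ne = rowLen-add-other i [] i' (ne ∘ cong suc)
rowLen-add-other (suc i) (a ∷ as) zero     ne = refl
rowLen-add-other (suc i) (a ∷ as) (suc i') ne = rowLen-add-other i as i' (ne ∘ cong suc)

rowLen-del-same : ∀ i μ → rowLen (delBox i μ) i ≡ rowLen μ i ∸ 1
rowLen-del-same i       []       = refl
rowLen-del-same zero    (a ∷ as) = refl
rowLen-del-same (suc i) (a ∷ as) = rowLen-del-same i as

rowLen-del-other : ∀ i μ i' → i' ≢ i → rowLen (delBox i μ) i' ≡ rowLen μ i'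
rowLen-del-other i       []       i'       ne = refl
rowLen-del-other zero    (a ∷ as) zero     ne = ⊥-elim (ne refl)
rowLen-del-other zero    (a ∷ as) (suc i') ne = refl
rowLen-del-other (suc i) (a ∷ as) zero     ne = refl
rowLen-del-other (suc i) (a ∷ as) (suc i') ne = rowLen-del-other i as i' (ne ∘ cong suc)

partner-snoc-old : ∀ ι a b v {w} → partner ι v ≡ just w → partner (ι ++ (a , b) ∷ []) v ≡ just w
partner-snoc-old ((a' , b') ∷ ps) a b v e with a' ≡ᵇ v
... | true = e
... | false with b' ≡ᵇ v
...   | true  = e
...   | false = partner-snoc-old ps a b v e

partner-snoc-fresh : ∀ ι a b v → partner ι v ≡ nothing → partner (ι ++ (a , b) ∷ []) v ≡ partner ((a , b) ∷ []) v
partner-snoc-fresh [] a b v e = refl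
partner-snoc-fresh ((a' , b') ∷ ps) a b v e with a' ≡ᵇ v
... | false with b' ≡ᵇ v
...   | false = partner-snoc-fresh ps a b v e

partner1-a : ∀ a b → partner ((a , b) ∷ []) a ≡ just b
partner1-a a b with a ≡ᵇ a in eq
... | true  = refl
... | false = ⊥-elim (≡ᵇ-false {a} {a} eq refl)

partner1-b : ∀ a b → a ≢ b → partner ((a , b) ∷ []) b ≡ just a
partner1-b a b ne with a ≡ᵇ b in eq
... | true = ⊥-elim (ne (≡ᵇ-true eq))
... | false with b ≡ᵇ b in eq2
...   | true  = refl
...   | false = ⊥-elim (≡ᵇ-false {b} {b} eq2 refl)

partner1-inv : ∀ a b v {w} → partner ((a , b) ∷ []) v ≡ just w → (v ≡ a × w ≡ b) ⊎ (v ≡ b × w ≡ a)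
partner1-inv a b v e with a ≡ᵇ v in eq
... | true = inj₁ (sym (≡ᵇ-true eq) , sym (just-injective e))
... | false with b ≡ᵇ v in eq2
...   | true = inj₂ (sym (≡ᵇ-true eq2) , sym (just-injective e))

partner-snoc-inv : ∀ ι a b v {w} → partner (ι ++ (a , b) ∷ []) v ≡ just w →
  partner ι v ≡ just w ⊎ ((v ≡ a × w ≡ b) ⊎ (v ≡ b × w ≡ a))
partner-snoc-inv ι a b v e with partner ι v in eq
... | just w' = inj₁ (cong just (just-injective (trans (sym (partner-snoc-old ι a b v eq)) e)))
... | nothing = inj₂ (partner1-inv a b v (trans (sym (partner-snoc-fresh ι a b v eq)) e))

partner-new-a : ∀ ι a b → partner ι a ≡ nothing → partner (ι ++ (a , b) ∷ []) a ≡ just b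
partner-new-a ι a b e = trans (partner-snoc-fresh ι a b a e) (partner1-a a b)

partner-new-b : ∀ ι a b → a ≢ b → partner ι b ≡ nothing → partner (ι ++ (a , b) ∷ []) b ≡ just a
partner-new-b ι a b ne e = trans (partner-snoc-fresh ι a b b e) (partner1-b a b ne)

memL-true : ∀ k xs → memL k xs ≡ true → Σ ℕ λ c → entryAt xs c ≡ just k
memL-true k (x ∷ xs) e with x ≡ᵇ k in eq
... | true = 0 , cong just (≡ᵇ-true eq)
... | false with memL-true k xs e
...   | (c , g) = suc c , g

memL-intro : ∀ k xs c → entryAt xs c ≡ just k → memL k xs ≡ true
memL-intro k (x ∷ xs) c e with x ≡ᵇ k in eq
... | true = refl
memL-intro k (x ∷ xs) zero    e | false = ⊥-elim (≡ᵇ-false eq (just-injective e))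
memL-intro k (x ∷ xs) (suc c) e | false = memL-intro k xs c e

not-true : ∀ (b : Bool) → b ≢ true → b ≡ false
not-true true  f = ⊥-elim (f refl)
not-true false f = refl

rowOfFrom-just : ∀ n v T {i} → rowOfFrom n v T ≡ just i → Σ ℕ λ i0 → (n + i0 ≡ i) × (Σ ℕ λ c → get T i0 c ≡ just v)
rowOfFrom-just n v (row ∷ rs) e with memL v row in eq
... | true = 0 , trans (+-identityʳ n) (just-injective e) , memL-true v row eq
... | false with rowOfFrom-just (suc n) v rs e
...   | (i0 , p , g) = suc i0 , trans (+-suc n i0) p , g

rowOfFrom-get : ∀ n v T i0 c → get T i0 c ≡ just v → (∀ i' → i' < i0 → memL v (rowAt T i') ≡ false) →
  rowOfFrom n v T ≡ just (n + i0)
rowOfFrom-get n v [] i0 c () h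
rowOfFrom-get n v (row ∷ rs) zero c g h rewrite memL-intro v row c g = cong just (sym (+-identityʳ n))
rowOfFrom-get n v (row ∷ rs) (suc i0) c g h rewrite h 0 z<s =
  trans (rowOfFrom-get (suc n) v rs i0 c g (λ i' lt → h (suc i') (s<s lt))) (cong just (sym (+-suc n i0)))

rowOf-get : ∀ T v {i} → rowOf T v ≡ just i → Σ ℕ λ c → get T i c ≡ just v
rowOf-get T v e with rowOfFrom-just 0 v T e
... | (i0 , refl , g) = g

get-rowOf : ∀ {T} → IsTab T → ∀ i c v → get T i c ≡ just v → rowOf T v ≡ just i
get-rowOf {T} tb i c v g = rowOfFrom-get 0 v T i c g
  (λ i' lt → not-true _ (λ mt → let (c' , g') = memL-true v (rowAt T i') mt
                                 in <-irrefl (proj₁ (IsTab.distinct tb g' g)) lt))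

record SunInv (t : ℕ) (μ : Shape) (ι : Inv) (T : Tab) : Set where
  field
    shape      : ∀ i → rowLen μ i ≡ lenR T i
    tableau    : IsTab T
    entryRange : ∀ {i c v} → get T i c ≡ just v → (1 ≤ v) × (v < t)
    pairRange  : ∀ {v w} → partner ι v ≡ just w → (1 ≤ v) × (v < t) × (w < t)
    disjoint   : ∀ {v w} → partner ι v ≡ just w → InT T v → ⊥
    clockPos   : 1 ≤ t

  unpaired : ∀ {v} → t ≤ v → partner ι v ≡ nothing
  unpaired t≤v = notJust _ (λ p → <-irrefl refl (<-≤-trans (proj₁ (proj₂ (pairRange p))) t≤v))

  unpairedIn : ∀ {v} → InT T v → partner ι v ≡ nothing
  unpairedIn it = notJust _ (λ p → disjoint p it)

get[] : ∀ i c → get [] i c ≡ nothing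
get[] zero    c = refl
get[] (suc i) c = refl

lenR[] : ∀ i → lenR [] i ≡ 0
lenR[] zero    = refl
lenR[] (suc i) = refl

sunInv-start : SunInv 1 [] [] []
sunInv-start = record
  { shape = λ i → sym (lenR[] i)
  ; tableau = record
      { lenDec   = λ i → ≤-reflexive (trans (lenR[] (suc i)) (sym (lenR[] i)))
      ; rowInc   = λ {i} {c} g → ⊥-elim (empty {i} {c} g)
      ; colInc   = λ {i} {i'} {c} g → ⊥-elim (empty {i} {c} g)
      ; distinct = λ {i} {i'} {c} g → ⊥-elim (empty {i} {c} g) }
  ; entryRange = λ {i} {c} g → ⊥-elim (empty {i} {c} g)
  ; pairRange = λ ()
  ; disjoint = λ ()
  ; clockPos = s≤s z≤n }
  where
  empty : ∀ {i c v} → get [] i c ≡ just v → ⊥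
  empty {i} {c} g = just≢nothing (trans (sym g) (get[] i c))

positive⇒suc : ∀ n → 0 < n → Σ ℕ λ m → n ≡ suc m
positive⇒suc (suc m) _ = m , refl

module Contract {t μ ι T} (G : SunInv t μ ι T) (i : ℕ) (cd : CanDel μ i) where
  open SunInv G

  x : ℕ
  x = proj₁ (colDelete i T)

  T1 : Tab
  T1 = proj₂ (colDelete i T)

  c1 : ℕ
  c1 = proj₁ (positive⇒suc (lenR T i) (subst (0 <_) (shape i) (proj₁ cd)))

  len-i : lenR T i ≡ suc c1
  len-i = proj₂ (positive⇒suc (lenR T i) (subst (0 <_) (shape i) (proj₁ cd)))

  corner : lenR T (suc i) ≤ c1
  corner = ≤-pred (subst₂ _<_ (shape (suc i)) (trans (shape i) len-i) (proj₂ cd))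

  D : BumpState T i c1 0 x (proj₁ (colDelete-spec tableau i c1 len-i corner)) T1
  D = proj₂ (colDelete-spec tableau i c1 len-i corner)

  module F = Deletion tableau D

  xInT : InT T x
  xInT = 0 , subst (InCol T 0) (sym F.xY) (F.chainCol 0 z≤n)

  x<t : x < t
  x<t = let (_ , ρ , g) = xInT in proj₂ (entryRange g)

  keep : ∀ {v} → InT T v → v ≢ x → InT T1 v
  keep {v} (c , ic) nx with F.move c v ic nx
  ... | F.stays ic' _        = c , ic'
  ... | F.shifts {c'} _ _ _ ic' = c' , ic'

  sub : ∀ {v} → InT T1 v → InT T v
  sub {v} (c , ic) = F.sub c v ic

  ι' : Inv
  ι' = ι ++ (x , t) ∷ []

  shape' : ∀ i' → rowLen (delBox i μ) i' ≡ lenR T1 i'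
  shape' i' with i' ≟ i
  ... | yes refl = trans (rowLen-del-same i μ) (trans (cong (_∸ 1) (trans (shape i) len-i)) (sym (BumpState.lenCorner D)))
  ... | no ne    = trans (rowLen-del-other i μ i' ne) (trans (shape i') (sym (BumpState.lenOther D i' ne)))

  pairRange' : ∀ {v w} → partner ι' v ≡ just w → (1 ≤ v) × (v < suc t) × (w < suc t)
  pairRange' {v} {w} e with partner-snoc-inv ι x t v e
  ... | inj₁ p = let (a , b , c) = pairRange p in a , <-trans b (n<1+n t) , <-trans c (n<1+n t)
  ... | inj₂ (inj₁ (refl , refl)) = let (_ , _ , g) = xInT in proj₁ (entryRange g) , <-trans x<t (n<1+n t) , n<1+n t
  ... | inj₂ (inj₂ (refl , refl)) = clockPos , n<1+n t , <-trans x<t (n<1+n t)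

  disjoint' : ∀ {v w} → partner ι' v ≡ just w → InT T1 v → ⊥
  disjoint' {v} e it with partner-snoc-inv ι x t v e
  ... | inj₁ p = disjoint p (sub it)
  ... | inj₂ (inj₁ (refl , refl)) = let (c , ρ , g) = it in F.fresh ρ c g
  ... | inj₂ (inj₂ (refl , refl)) = let (c , ρ , g) = sub it in <-irrefl refl (proj₂ (entryRange g))

  G' : SunInv (suc t) (delBox i μ) ι' T1
  G' = record
    { shape = shape'
    ; tableau = BumpState.isTab D
    ; entryRange = λ {ρ} {c} g → let (_ , _ , g') = sub (c , ρ , g) ; (a , b) = entryRange g'
                                 in a , <-trans b (n<1+n t)
    ; pairRange = pairRange'
    ; disjoint = disjoint'
    ; clockPos = s≤s z≤n }

  pairs-x : ∀ {v} → x ≡ v → partner ι' v ≡ just t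
  pairs-x refl = partner-new-a ι x t (unpairedIn xInT)

  pairs-t : partner ι' t ≡ just x
  pairs-t = partner-new-b ι x t (<⇒≢ x<t) (unpaired ≤-refl)

  pairs-old : ∀ {v w} → partner ι v ≡ just w → partner ι' v ≡ just w
  pairs-old p = partner-snoc-old ι x t _ p

module Expand {t μ ι T} (G : SunInv t μ ι T) (i : ℕ) (ca : CanAdd μ i) where
  open SunInv G
  open TabLemmas tableau
  open Append i t T

  shape' : ∀ i' → rowLen (addBox i μ) i' ≡ lenR T⁺ i'
  shape' i' with i' ≟ i
  ... | yes refl = trans (rowLen-add-same i μ) (trans (cong suc (shape i)) (sym len-same))
  ... | no ne    = trans (rowLen-add-other i μ i' ne) (trans (shape i') (sym (len-other i' ne)))

  lenDec' : ∀ i' → lenR T⁺ (suc i') ≤ lenR T⁺ i'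
  lenDec' i' with suc i' ≟ i | i' ≟ i
  ... | yes refl | yes e   = ⊥-elim (<-irrefl e (n<1+n i'))
  ... | yes refl | no ne   = subst₂ _≤_ (sym len-same) (sym (len-other i' ne))
                               (subst₂ _<_ (shape (suc i')) (shape i') ca)
  ... | no ne1   | yes refl = subst₂ _≤_ (sym (len-other (suc i') ne1)) (sym len-same)
                               (≤-trans (IsTab.lenDec tableau i') (n≤1+n _))
  ... | no ne1   | no ne   = subst₂ _≤_ (sym (len-other (suc i') ne1)) (sym (len-other i' ne)) (IsTab.lenDec tableau i')

  entryRange' : ∀ {ρ c v} → get T⁺ ρ c ≡ just v → (1 ≤ v) × (v < suc t)
  entryRange' {ρ} {c} g with get-inv ρ c g
  ... | inj₁ g'               = let (a , b) = entryRange g' in a , <-trans b (n<1+n t)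
  ... | inj₂ (_ , _ , refl)   = clockPos , n<1+n t

  -- t is larger than every other letter, so it can sit at the end of a row
  rowInc' : ∀ {ρ a b va vb} → get T⁺ ρ a ≡ just va → get T⁺ ρ b ≡ just vb → a < b → va < vb
  rowInc' {ρ} {a} {b} g1 g2 lt with get-inv ρ a g1 | get-inv ρ b g2
  ... | inj₁ g1'                | inj₁ g2'           = IsTab.rowInc tableau g1' g2' lt
  ... | inj₁ g1'                | inj₂ (_ , _ , refl) = proj₂ (entryRange g1')
  ... | inj₂ (refl , refl , refl) | inj₁ g2'         = ⊥-elim (<-asym lt (get-< T ρ b g2'))
  ... | inj₂ (refl , refl , refl) | inj₂ (_ , refl , _) = ⊥-elim (<-irrefl refl lt)

  colInc' : ∀ {ρ ρ' c va vb} → get T⁺ ρ c ≡ just va → get T⁺ ρ' c ≡ just vb → ρ < ρ' → va < vb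
  colInc' {ρ} {ρ'} {c} g1 g2 lt with get-inv ρ c g1 | get-inv ρ' c g2
  ... | inj₁ g1'                | inj₁ g2'           = IsTab.colInc tableau g1' g2' lt
  ... | inj₁ g1'                | inj₂ (_ , _ , refl) = proj₂ (entryRange g1')
  ... | inj₂ (refl , refl , refl) | inj₁ g2'         = ⊥-elim (<-irrefl refl (<-≤-trans (get-< T ρ' c g2') (lenMono (<⇒≤ lt))))
  ... | inj₂ (refl , refl , refl) | inj₂ (refl , _ , _) = ⊥-elim (<-irrefl refl lt)

  distinct' : ∀ {ρ ρ' a b v} → get T⁺ ρ a ≡ just v → get T⁺ ρ' b ≡ just v → (ρ ≡ ρ') × (a ≡ b)
  distinct' {ρ} {ρ'} {a} {b} g1 g2 with get-inv ρ a g1 | get-inv ρ' b g2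
  ... | inj₁ g1'              | inj₁ g2'              = IsTab.distinct tableau g1' g2'
  ... | inj₁ g1'              | inj₂ (_ , _ , refl)   = ⊥-elim (<-irrefl refl (proj₂ (entryRange g1')))
  ... | inj₂ (_ , _ , refl)   | inj₁ g2'              = ⊥-elim (<-irrefl refl (proj₂ (entryRange g2')))
  ... | inj₂ (refl , refl , _) | inj₂ (refl , refl , _) = refl , refl

  disjoint' : ∀ {v w} → partner ι v ≡ just w → InT T⁺ v → ⊥
  disjoint' {v} p (c , ρ , g) with get-inv ρ c g
  ... | inj₁ g'             = disjoint p (c , ρ , g')
  ... | inj₂ (_ , _ , refl) = <-irrefl refl (proj₁ (proj₂ (pairRange p)))

  G' : SunInv (suc t) (addBox i μ) ι T⁺
  G' = record
    { shape = shape'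
    ; tableau = record { lenDec = lenDec' ; rowInc = rowInc' ; colInc = colInc' ; distinct = distinct' }
    ; entryRange = entryRange'
    ; pairRange = λ p → let (a , b , c) = pairRange p in a , <-trans b (n<1+n t) , <-trans c (n<1+n t)
    ; disjoint = disjoint'
    ; clockPos = s≤s z≤n }

  newIn : InT T⁺ t
  newIn = lenR T i , i , get-new

clock : ℕ → List Step → ℕ
clock t []       = t
clock t (_ ∷ ss) = clock (suc t) ss

after : Shape → List Step → Shape
after μ []       = μ
after μ (s ∷ ss) = after (applyStep s μ) ss

clock-length : ∀ t ss → clock t ss ≡ t + length ss
clock-length t []       = sym (+-identityʳ t)
clock-length t (_ ∷ ss) = trans (clock-length (suc t) ss) (sym (+-suc t (length ss)))

StateProp : Set₁
StateProp = ℕ → Shape → Inv → Tab → Set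

After : StateProp → ℕ → Shape → Inv → Tab → List Step → Set
After P t μ ι T ss = P (clock t ss) (after μ ss) (proj₁ (sunFrom t ι T ss)) (proj₂ (sunFrom t ι T ss))

record Preserved (P : StateProp) : Set where
  field
    onExpand   : ∀ {t μ ι T} i → P t μ ι T → CanAdd μ i → P (suc t) (addBox i μ) ι (appendRow i t T)
    onContract : ∀ {t μ ι T} i → P t μ ι T → CanDel μ i →
                 P (suc t) (delBox i μ) (ι ++ (proj₁ (colDelete i T) , t) ∷ []) (proj₂ (colDelete i T))

propagate : ∀ {P} → Preserved P → ∀ ss {t μ ι T} → P t μ ι T → ValidFrom μ ss → After P t μ ι T ss
propagate pr []                p _        = p
propagate pr (expand i ∷ ss)   p (ok , v) = propagate pr ss (Preserved.onExpand pr i p ok) v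
propagate pr (contract i ∷ ss) p (ok , v) = propagate pr ss (Preserved.onContract pr i p ok) v

sunFrom-++ : ∀ xs ys {t ι T} →
  sunFrom t ι T (xs ++ ys) ≡ sunFrom (clock t xs) (proj₁ (sunFrom t ι T xs)) (proj₂ (sunFrom t ι T xs)) ys
sunFrom-++ []                ys = refl
sunFrom-++ (expand i ∷ xs)   ys = sunFrom-++ xs ys
sunFrom-++ (contract i ∷ xs) ys = sunFrom-++ xs ys

ValidFrom-++ : ∀ xs ys {μ} → ValidFrom μ (xs ++ ys) → ValidFrom μ xs × ValidFrom (after μ xs) ys
ValidFrom-++ []       ys v        = tt , v
ValidFrom-++ (s ∷ xs) ys (ok , v) = let (vx , vy) = ValidFrom-++ xs ys v in (ok , vx) , vy

sunPreserved : Preserved SunInv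
sunPreserved = record { onExpand = λ i G → Expand.G' G i ; onContract = λ i G → Contract.G' G i }

-- The first three constructors force k ∈ Des(T), Des(T/ι), Des(ι); the last
-- three are the dual configurations, which exclude k from Des(ι , T).
data Witness (k : ℕ) (ι : Inv) (T : Tab) : Bool → Set where
  tabDes    : ∀ {i c j d} → get T i c ≡ just k → get T j d ≡ just (suc k) → i < j → Witness k ι T true
  tabInvDes : ∀ {w} → InT T k → partner ι (suc k) ≡ just w → Witness k ι T true
  invDes    : ∀ {a b} → partner ι k ≡ just a → partner ι (suc k) ≡ just b → b < a → Witness k ι T true
  tabAsc    : ∀ {i c j d} → get T i c ≡ just k → get T j d ≡ just (suc k) → j ≤ i → Witness k ι T false
  invTabAsc : ∀ {a} → partner ι k ≡ just a → InT T (suc k) → Witness k ι T false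
  invAsc    : ∀ {a b} → partner ι k ≡ just a → partner ι (suc k) ≡ just b → a < b → Witness k ι T false

-- an expansion only adds a letter, so every witness survives
witness-expand : ∀ {k ι T b} i t → Witness k ι T b → Witness k ι (appendRow i t T) b
witness-expand i t (tabDes g1 g2 lt)        = tabDes (Append.get-old i t _ _ _ g1) (Append.get-old i t _ _ _ g2) lt
witness-expand i t (tabInvDes (c , ρ , g) p) = tabInvDes (c , ρ , Append.get-old i t _ _ _ g) p
witness-expand i t (invDes p q lt)          = invDes p q lt
witness-expand i t (tabAsc g1 g2 lt)        = tabAsc (Append.get-old i t _ _ _ g1) (Append.get-old i t _ _ _ g2) lt
witness-expand i t (invTabAsc p (c , ρ , g)) = invTabAsc p (c , ρ , Append.get-old i t _ _ _ g)
witness-expand i t (invAsc p q lt)          = invAsc p q lt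

-- Under a contraction ejecting x, a witness in T either survives in the new
-- tableau, or x ∈ {k , k+1} and x becomes paired with the current time t,
-- which is larger than every other partner: the witness turns into one of
-- the mixed or involution witnesses of the same kind.
module WitnessContract {t μ ι T} (G : SunInv t μ ι T) (i : ℕ) (cd : CanDel μ i) (k : ℕ) where
  open SunInv G
  module C = Contract G i cd
  open C using (x; T1; ι'; pairs-x; pairs-old)
  open TabLemmas
  tab1 : IsTab T1
  tab1 = BumpState.isTab C.D

  witness-contract : ∀ {b} → Witness k ι T b → Witness k ι' T1 b
  witness-contract (tabDes {i1} {c} {j} {d} g1 g2 lt) with C.F.leftPair (i1 , g1) (j , g2) (succBelow⇒weaklyLeft tableau g1 g2 lt)
  ... | (x≢k , survive) with ≡-or-≢ x (suc k)
  ...   | inj₁ e  = tabInvDes (C.keep (c , i1 , g1) (x≢k ∘ sym)) (pairs-x e)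
  ...   | inj₂ ne with survive ne
  ...     | (p' , q' , (i' , g1') , (j' , g2') , le) with j' ≤? i'
  ...       | yes jl = ⊥-elim (<-irrefl refl (<-≤-trans (succWeaklyAbove⇒right tab1 g1' g2' jl) le))
  ...       | no nj  = tabDes g1' g2' (≰⇒> nj)
  witness-contract (tabInvDes it p) with ≡-or-≢ x k
  ... | inj₁ e  = invDes (pairs-x e) (pairs-old p) (proj₂ (proj₂ (pairRange p)))
  ... | inj₂ ne = tabInvDes (C.keep it (ne ∘ sym)) (pairs-old p)
  witness-contract (invDes p q lt) = invDes (pairs-old p) (pairs-old q) lt
  witness-contract (tabAsc {i1} {c} {j} {d} g1 g2 le) with C.F.rightPair (i1 , g1) (j , g2) (succWeaklyAbove⇒right tableau g1 g2 le)
  ... | (x≢k+1 , survive) with ≡-or-≢ x k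
  ...   | inj₁ e  = invTabAsc (pairs-x e) (C.keep (d , j , g2) (x≢k+1 ∘ sym))
  ...   | inj₂ ne with survive ne
  ...     | (p' , q' , (i' , g1') , (j' , g2') , lt) with j' ≤? i'
  ...       | yes jl = tabAsc g1' g2' jl
  ...       | no nj  = ⊥-elim (<-irrefl refl (<-≤-trans lt (succBelow⇒weaklyLeft tab1 g1' g2' (≰⇒> nj))))
  witness-contract (invTabAsc p it) with ≡-or-≢ x (suc k)
  ... | inj₁ e  = invAsc (pairs-old p) (pairs-x e) (proj₂ (proj₂ (pairRange p)))
  ... | inj₂ ne = invTabAsc (pairs-old p) (C.keep it (ne ∘ sym))
  witness-contract (invAsc p q lt) = invAsc (pairs-old p) (pairs-old q) lt

-- the status of position k (D says whether k is a descent of 𝒯) together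
-- with a matching witness
Verdict : ℕ → Inv → Tab → Set → Set
Verdict k ι T D = (D × Witness k ι T true) ⊎ (¬ D × Witness k ι T false)

verdict-map : ∀ {k ι T ι' T' D} → (∀ {b} → Witness k ι T b → Witness k ι' T' b) → Verdict k ι T D → Verdict k ι' T' D
verdict-map f (inj₁ (d , w))  = inj₁ (d , f w)
verdict-map f (inj₂ (nd , w)) = inj₂ (nd , f w)

Tracked : ℕ → Set → StateProp
Tracked k D t μ ι T = SunInv t μ ι T × Verdict k ι T D

trackedPreserved : ∀ k D → Preserved (Tracked k D)
trackedPreserved k D = record
  { onExpand   = λ i (G , V) ca → Expand.G' G i ca , verdict-map (witness-expand i _) V
  ; onContract = λ i (G , V) cd → Contract.G' G i cd , verdict-map (WitnessContract.witness-contract G i cd k) V }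

module Reading {t μ ι T} (G : SunInv t μ ι T) (k : ℕ) where
  open SunInv G

  rowIn : ∀ {v i} → rowOf T v ≡ just i → InT T v
  rowIn {v} e = let (c , g) = rowOf-get T v e in c , _ , g

  rowOf' : ∀ {i c v} → get T i c ≡ just v → rowOf T v ≡ just i
  rowOf' {i} {c} {v} = get-rowOf tableau i c v

  descent : Witness k ι T true → DesIT (ι , T) k
  descent (tabDes g1 g2 lt)        = inj₂ (inj₁ (_ , _ , rowOf' g1 , rowOf' g2 , lt))
  descent (tabInvDes (c , i , g) p) = inj₂ (inj₂ (i , _ , rowOf' g , p))
  descent (invDes p q lt)          = inj₁ (_ , _ , p , q , lt)

  -- paired letters are not in T, and ι is a function
  noDescent : Witness k ι T false → ¬ DesIT (ι , T) k
  noDescent (tabAsc {i} {c} g1 g2 le) (inj₁ (_ , _ , p , _ , _)) = disjoint p (c , i , g1)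
  noDescent (tabAsc g1 g2 le) (inj₂ (inj₁ (_ , _ , r1 , r2 , lt)))
    with trans (sym r1) (rowOf' g1) | trans (sym r2) (rowOf' g2)
  ... | refl | refl = <-irrefl refl (<-≤-trans lt le)
  noDescent (tabAsc {j = j} {d} g1 g2 le) (inj₂ (inj₂ (_ , _ , _ , p))) = disjoint p (d , j , g2)
  noDescent (invTabAsc p it) (inj₁ (_ , _ , _ , q , _))        = disjoint q it
  noDescent (invTabAsc p it) (inj₂ (inj₁ (_ , _ , r1 , _ , _))) = disjoint p (rowIn r1)
  noDescent (invTabAsc p it) (inj₂ (inj₂ (_ , _ , r1 , _)))     = disjoint p (rowIn r1)
  noDescent (invAsc p q lt) (inj₁ (_ , _ , p' , q' , lt')) with trans (sym p) p' | trans (sym q) q'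
  ... | refl | refl = <-asym lt lt'
  noDescent (invAsc p q lt) (inj₂ (inj₁ (_ , _ , r1 , _ , _))) = disjoint p (rowIn r1)
  noDescent (invAsc p q lt) (inj₂ (inj₂ (_ , _ , r1 , _)))     = disjoint p (rowIn r1)

  verdict⇔ : ∀ {D} → Verdict k ι T D → D ⇔ DesIT (ι , T) k
  verdict⇔ (inj₁ (d , w))  = mk⇔ (λ _ → descent w) (λ _ → d)
  verdict⇔ (inj₂ (nd , w)) = mk⇔ (⊥-elim ∘ nd) (⊥-elim ∘ noDescent w)

  -- all letters lie in [1 , t), so no k outside [1 , t - 1) is a descent
  outOfRange : k ≡ 0 ⊎ t ≤ suc k → ¬ DesIT (ι , T) k
  outOfRange (inj₁ refl) (inj₁ (_ , _ , p , _ , _))     = <-irrefl refl (proj₁ (pairRange p))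
  outOfRange (inj₁ refl) (inj₂ (inj₁ (_ , _ , r1 , _ , _))) =
    let (c , i , g) = rowIn r1 in <-irrefl refl (proj₁ (entryRange g))
  outOfRange (inj₁ refl) (inj₂ (inj₂ (_ , _ , r1 , _)))  =
    let (c , i , g) = rowIn r1 in <-irrefl refl (proj₁ (entryRange g))
  outOfRange (inj₂ le) (inj₁ (_ , _ , _ , q , _))        = <-irrefl refl (<-≤-trans (proj₁ (proj₂ (pairRange q))) le)
  outOfRange (inj₂ le) (inj₂ (inj₁ (_ , _ , _ , r2 , _))) =
    let (c , i , g) = rowIn r2 in <-irrefl refl (<-≤-trans (proj₂ (entryRange g)) le)
  outOfRange (inj₂ le) (inj₂ (inj₂ (_ , _ , _ , q)))     = <-irrefl refl (<-≤-trans (proj₁ (proj₂ (pairRange q))) le)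

TwoSteps : ℕ → Shape → Inv → Tab → Step → Step → Set
TwoSteps t μ ι T s s' = After (Tracked t (DesPair s s')) t μ ι T (s ∷ s' ∷ [])

-- k and k+1 are both placed in T: k+1 lands in a lower row iff i < j
twoSteps-EE : ∀ {t μ ι T} i j → SunInv t μ ι T → ValidFrom μ (expand i ∷ expand j ∷ []) →
  TwoSteps t μ ι T (expand i) (expand j)
twoSteps-EE {t} {μ} {ι} {T} i j G (ca , ca' , _) = G2 , verdict
  where
  T₁ : Tab
  T₁ = appendRow i t T
  G1 : SunInv (suc t) (addBox i μ) ι T₁
  G1 = Expand.G' G i ca
  G2 : SunInv (suc (suc t)) (addBox j (addBox i μ)) ι (appendRow j (suc t) T₁)
  G2 = Expand.G' G1 j ca'
  k-in : get (appendRow j (suc t) T₁) i (lenR T i) ≡ just t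
  k-in = Append.get-old j (suc t) T₁ i (lenR T i) (Append.get-new i t T)
  k+1-in : get (appendRow j (suc t) T₁) j (lenR T₁ j) ≡ just (suc t)
  k+1-in = Append.get-new j (suc t) T₁
  verdict : Verdict t ι (appendRow j (suc t) T₁) (i < j)
  verdict with i <? j
  ... | yes lt = inj₁ (lt , tabDes k-in k+1-in lt)
  ... | no nl  = inj₂ (nl , tabAsc k-in k+1-in (≮⇒≥ nl))

-- k is placed and then the contraction at k+1 ejects x: either x = k, now
-- paired with k+1, or k stays in T while k+1 is paired
twoSteps-EC : ∀ {t μ ι T} i j → SunInv t μ ι T → ValidFrom μ (expand i ∷ contract j ∷ []) →
  TwoSteps t μ ι T (expand i) (contract j)
twoSteps-EC {t} {μ} {ι} {T} i j G (ca , cd , _) = C.G' , inj₁ (tt , witness)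
  where
  G1 : SunInv (suc t) (addBox i μ) ι (appendRow i t T)
  G1 = Expand.G' G i ca
  module C = Contract G1 j cd
  witness : Witness t C.ι' C.T1 true
  witness with ≡-or-≢ C.x t
  ... | inj₁ e  = invDes (C.pairs-x e) (subst (λ z → partner C.ι' (suc t) ≡ just z) e C.pairs-t) (n<1+n t)
  ... | inj₂ ne = tabInvDes (C.keep (Expand.newIn G i ca) (ne ∘ sym)) C.pairs-t

-- the contraction at k pairs k with x, then k+1 is placed in T
twoSteps-CE : ∀ {t μ ι T} i j → SunInv t μ ι T → ValidFrom μ (contract i ∷ expand j ∷ []) →
  TwoSteps t μ ι T (contract i) (expand j)
twoSteps-CE {t} {μ} {ι} {T} i j G (cd , ca , _) =
  Expand.G' C.G' j ca , inj₂ ((λ ()) , invTabAsc C.pairs-t (Expand.newIn C.G' j ca))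
  where
  module C = Contract G i cd

-- two contractions pair k with x1 and k+1 with x2; comparing the corner
-- columns, x2 < x1 iff the second corner lies in a higher row (j < i)
twoSteps-CC : ∀ {t μ ι T} i j → SunInv t μ ι T → ValidFrom μ (contract i ∷ contract j ∷ []) →
  TwoSteps t μ ι T (contract i) (contract j)
twoSteps-CC {t} {μ} {ι} {T} i j G (cd , cd' , _) = C2.G' , verdict
  where
  module C1 = Contract G i cd
  module C2 = Contract C1.G' j cd'
  module R = TwoDeletions (SunInv.tableau G) C1.D C2.D
  open TabLemmas (SunInv.tableau G)
  pk : partner C2.ι' t ≡ just C1.x
  pk = C2.pairs-old C1.pairs-t
  pk+1 : partner C2.ι' (suc t) ≡ just C2.x
  pk+1 = C2.pairs-t
  verdict : Verdict t C2.ι' C2.T1 (j < i)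
  verdict with j <? i
  ... | yes lt = inj₁ (lt , invDes pk pk+1 (R.ejected-decreases c1≤c2))
    where
    c1≤c2 : C1.c1 ≤ C2.c1
    c1≤c2 = ≤-pred (subst₂ _≤_ C1.len-i C2.len-i
              (≤-trans (lenMono (<⇒≤ lt)) (≤-reflexive (sym (BumpState.lenOther C1.D j (λ e → <-irrefl e lt))))))
  ... | no nl = inj₂ (nl , invAsc pk pk+1 (R.ejected-increases c2<c1))
    where
    c2<c1 : C2.c1 < C1.c1
    c2<c1 with m≤n⇒m<n∨m≡n (≮⇒≥ nl)
    ... | inj₂ refl = subst (suc C2.c1 ≤_) (BumpState.lenCorner C1.D) (≤-reflexive (sym C2.len-i))
    ... | inj₁ i<j  = ≤-trans (≤-reflexive (sym C2.len-i))
                        (≤-trans (≤-reflexive (BumpState.lenOther C1.D j (λ e → <-irrefl (sym e) i<j)))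
                          (≤-trans (lenMono i<j) C1.corner))

twoSteps : ∀ {t μ ι T} s s' → SunInv t μ ι T → ValidFrom μ (s ∷ s' ∷ []) → TwoSteps t μ ι T s s'
twoSteps (expand i)   (expand j)   = twoSteps-EE i j
twoSteps (expand i)   (contract j) = twoSteps-EC i j
twoSteps (contract i) (expand j)   = twoSteps-CE i j
twoSteps (contract i) (contract j) = twoSteps-CC i j

data Position (ss : List Step) : ℕ → Set where
  inside  : ∀ pre s s' post → ss ≡ pre ++ s ∷ s' ∷ post → Position ss (suc (length pre))
  outside : ∀ {k} → k ≡ 0 ⊎ length ss ≤ k → Position ss k

position : ∀ ss k → Position ss k
position ss             zero          = outside (inj₁ refl)
position []             (suc k)       = outside (inj₂ z≤n)
position (s ∷ [])       (suc k)       = outside (inj₂ (s≤s z≤n))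
position (s ∷ s' ∷ ss)  (suc zero)    = inside [] s s' ss refl
position (s ∷ s' ∷ ss)  (suc (suc k)) with position (s' ∷ ss) (suc k)
... | inside pre a b post e = inside (s ∷ pre) a b post (cong (s ∷_) e)
... | outside (inj₂ le)     = outside (inj₂ (s≤s le))

stepAt-middle : ∀ pre s rest → stepAt (pre ++ s ∷ rest) (suc (length pre)) ≡ just s
stepAt-middle []        s rest = refl
stepAt-middle (p ∷ pre) s rest = stepAt-middle pre s rest

stepAt-beyond : ∀ ss n → length ss < n → stepAt ss n ≡ nothing
stepAt-beyond ss       zero          _        = refl
stepAt-beyond []       (suc n)       _        = refl
stepAt-beyond (s ∷ ss) (suc zero)    (s≤s ())
stepAt-beyond (s ∷ ss) (suc (suc n)) (s≤s lt) = stepAt-beyond ss (suc n) lt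

desOsc-inside : ∀ pre s s' post → DesOsc (pre ++ s ∷ s' ∷ post) (suc (length pre)) ⇔ DesPair s s'
desOsc-inside pre s s' post = mk⇔
  (λ (a , b , ea , eb , dp) → subst₂ DesPair (just-injective (trans (sym ea) at-s)) (just-injective (trans (sym eb) at-s')) dp)
  (λ dp → s , s' , at-s , at-s' , dp)
  where
  at-s : stepAt (pre ++ s ∷ s' ∷ post) (suc (length pre)) ≡ just s
  at-s = stepAt-middle pre s (s' ∷ post)
  at-s' : stepAt (pre ++ s ∷ s' ∷ post) (suc (suc (length pre))) ≡ just s'
  at-s' = subst (λ L → stepAt L (suc (suc (length pre))) ≡ just s') (++-assoc pre (s ∷ []) (s' ∷ post))
            (subst (λ n → stepAt ((pre ++ s ∷ []) ++ s' ∷ post) (suc n) ≡ just s')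
               (trans (length-++ pre) (+-comm (length pre) 1))
               (stepAt-middle (pre ++ s ∷ []) s' post))

desOsc-outside : ∀ ss {k} → k ≡ 0 ⊎ length ss ≤ k → ¬ DesOsc ss k
desOsc-outside ss (inj₁ refl) (_ , _ , () , _)
desOsc-outside ss {k} (inj₂ le) (_ , _ , _ , e , _) = just≢nothing (trans (sym e) (stepAt-beyond ss (suc k) (s≤s le)))

sunInv-final : ∀ ss → ValidFrom [] ss → After SunInv 1 [] [] [] ss
sunInv-final ss = propagate sunPreserved ss sunInv-start

desIT-outside : ∀ ss → ValidFrom [] ss → ∀ {k} → k ≡ 0 ⊎ length ss ≤ k → ¬ DesIT (sunFrom 1 [] [] ss) k
desIT-outside ss v {k} out = Reading.outOfRange (sunInv-final ss v) k (map₂ range out)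
  where
  range : length ss ≤ k → clock 1 ss ≤ suc k
  range le = subst (_≤ suc k) (sym (clock-length 1 ss)) (s≤s le)

-- run Sun₁ up to position k, take the two steps there, and carry the
-- resulting verdict to the end
desIT-inside : ∀ pre s s' post → ValidFrom [] (pre ++ s ∷ s' ∷ post) →
  DesPair s s' ⇔ DesIT (sunFrom 1 [] [] (pre ++ s ∷ s' ∷ post)) (suc (length pre))
desIT-inside pre s s' post v =
  subst₂ (λ st n → DesPair s s' ⇔ DesIT st n) (sym sun-split) (clock-length 1 pre)
    (Reading.verdict⇔ (proj₁ final) k (proj₂ final))
  where
  k : ℕ
  k = clock 1 pre
  μ₁ : Shape
  μ₁ = after [] pre
  ι₁ : Inv
  ι₁ = proj₁ (sunFrom 1 [] [] pre)
  T₁ : Tab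
  T₁ = proj₂ (sunFrom 1 [] [] pre)
  ι₂ : Inv
  ι₂ = proj₁ (sunFrom k ι₁ T₁ (s ∷ s' ∷ []))
  T₂ : Tab
  T₂ = proj₂ (sunFrom k ι₁ T₁ (s ∷ s' ∷ []))

  valid-pre : ValidFrom [] pre
  valid-pre = proj₁ (ValidFrom-++ pre (s ∷ s' ∷ post) v)
  valid-rest : ValidFrom μ₁ (s ∷ s' ∷ post)
  valid-rest = proj₂ (ValidFrom-++ pre (s ∷ s' ∷ post) v)

  before : SunInv k μ₁ ι₁ T₁
  before = propagate sunPreserved pre sunInv-start valid-pre
  two : TwoSteps k μ₁ ι₁ T₁ s s'
  two = twoSteps s s' before (proj₁ (ValidFrom-++ (s ∷ s' ∷ []) post valid-rest))
  final : After (Tracked k (DesPair s s')) (suc (suc k)) (after μ₁ (s ∷ s' ∷ [])) ι₂ T₂ post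
  final = propagate (trackedPreserved k (DesPair s s')) post two (proj₂ (ValidFrom-++ (s ∷ s' ∷ []) post valid-rest))

  sun-split : sunFrom 1 [] [] (pre ++ s ∷ s' ∷ post) ≡ sunFrom (suc (suc k)) ι₂ T₂ post
  sun-split = trans (sunFrom-++ pre (s ∷ s' ∷ post)) (sunFrom-++ (s ∷ s' ∷ []) post)

proposition6p4 : (r : ℕ) (𝒯 : OscTab r) → (k : ℕ) → DesOsc (steps 𝒯) k ⇔ DesIT (Sun₁ 𝒯) k
proposition6p4 r (osc ss _ valid) k with position ss k
... | outside out = mk⇔ (⊥-elim ∘ desOsc-outside ss out) (⊥-elim ∘ desIT-outside ss valid out)
... | inside pre s s' post refl = ⇔-trans (desOsc-inside pre s s' post) (desIT-inside pre s s' post valid)
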